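{- Define integers $B'(n)$, $n\ge1$, by \[ \sum_{n=1}^\infty B'(n) q^n := \sum_{n=1}^\infty q^{n}(-q^{n+1};q)_\infty^2 (q^{n+1};q)_\infty (q^{n+1};q)_{n}. \] Then for every positive integer $n$ that is not the sum of two triangular numbers, $B'(n)=0$.
   Context: Series are formal power series in $q$ (or $|q|<1$). Notation: $(a;q)_n=\prod_{j=0}^{n-1}(1-aq^j)$, $(a;q)_\infty=\prod_{j=0}^{\infty}(1-aq^j)$, and $(a;q)_\infty^k$ denotes the $k$-th power of $(a;q)_\infty$. Triangular numbers are the integers $k(k+1)/2$ with $k\ge 0$. -}

module Defs where

open import Data.Nat using (ℕ; zero; suc; _+_; _∸_; _≡ᵇ_; _≤ᵇ_)
open import Data.Integer using (ℤ; 0ℤ; 1ℤ; -1ℤ) renaming (_+_ to _+ℤ_; _*_ to _*ℤ_; _-_ to _-ℤ_)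
open import Data.Bool using (if_then_else_)

-- Formal power series in q with integer coefficients: k ↦ coefficient of q^k.
PS : Set
PS = ℕ → ℤ

Σ< : ℕ → (ℕ → ℤ) → ℤ
Σ< zero    f = 0ℤ
Σ< (suc n) f = Σ< n f +ℤ f n

one : PS
one zero    = 1ℤ
one (suc _) = 0ℤ

_⊛_ : PS → PS → PS
(f ⊛ g) k = Σ< (suc k) (λ i → f i *ℤ g (k ∸ i))

infixl 7 _⊛_

shift : ℕ → PS → PS
shift n f k = if n ≤ᵇ k then f (k ∸ n) else 0ℤ

oneMinus : ℤ → ℕ → PS
oneMinus c e k = one k -ℤ (if k ≡ᵇ e then c else 0ℤ)

finProd : ℕ → (ℕ → PS) → PS
finProd zero    f = one
finProd (suc n) f = finProd n f ⊛ f n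

-- (c q^m ; q)_len = ∏_{j < len} (1 - c q^{m+j})
pochFin : ℤ → ℕ → ℕ → PS
pochFin c m len = finProd len (λ j → oneMinus c (m + j))

-- (c q^m ; q)_∞, defined coefficientwise: the coefficient of q^k is that of the
-- finite product over j ≤ k; the omitted factors (j > k) are ≡ 1 mod q^{k+1}.
pochInf : ℤ → ℕ → PS
pochInf c m k = pochFin c m (suc k) k

summand : ℕ → PS
summand n = shift n (pochInf -1ℤ (suc n) ⊛ pochInf -1ℤ (suc n)
                       ⊛ pochInf 1ℤ (suc n) ⊛ pochFin 1ℤ (suc n) n)

-- B'(k) = coefficient of q^k in Σ_{n ≥ 1} summand n; only n ≤ k contribute
-- (summand n is divisible by q^n).
B' : ℕ → ℤ
B' k = Σ< k (λ i → summand (suc i) k)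

-- triangular numbers T a = a(a+1)/2
T : ℕ → ℕ
T zero    = 0
T (suc a) = T a + suc a

-- Write ψ = (−q;q)²_∞ (q;q)_∞ (here Ψ 1) and Φ n = (q^{n+1};q)_n (−q^{n+1};q)²_∞ (q^{n+1};q)_∞,
-- so that the n-th summand is qⁿ Φ n and Φ 0 = ψ. The heart of the matter is Σ_{n≥0} qⁿ Φ n = ψ²,
-- which makes B'(n) the coefficient of qⁿ in ψ² − ψ.
-- The series F_j = Σ_n q^{n(2j+1)} Φ n satisfy (1 − q^{2j+1}) F_j = (1 − q^{2j+2}) F_{j+1}, because
-- (1 − q^{2n+2}) Φ (n+1) = (1 − q^{2n+1}) Φ n. Hence (q;q²)_J F_0 = (q²;q²)_J F_J, and modulo q^{2J+1}
-- this is (q²;q²)_J ψ, since F_J ≡ Φ 0 there. By Euler's identity (q;q²)_∞ (−q;q)_∞ = 1 it equals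
-- (q;q²)_J ψ², and cancelling (q;q²)_J gives F_0 = ψ².
-- Gauss's identity ψ = Σ_a q^{T a}, obtained from its finite form
-- (−q;q)_n² (q;q)_n = Σ_{k≤n} q^{T k} (q^{n+1-k};q)_k (q^{n+k+2};q)_{n-k} by telescoping in n,
-- shows that ψ lives on triangular numbers and ψ² on sums of two of them.
module Submission where

open import Defs
open import Level using (0ℓ)
open import Algebra.Bundles using (RawRing; CommutativeRing)
open import Algebra.Structures using (IsCommutativeRing)
open import Algebra.Morphism.Structures using (IsRingMonomorphism)
import Algebra.Morphism.RingMonomorphism as RingMonomorphism
open import Data.Bool using (if_then_else_)
open import Data.Empty using (⊥-elim)
open import Data.Integer using (ℤ; +_; -[1+_]; 0ℤ; 1ℤ; -1ℤ)
  renaming (_+_ to _+ℤ_; _*_ to _*ℤ_; -_ to -ℤ_; _-_ to _−ℤ_)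
import Data.Integer.Properties as ℤ
open import Data.Integer.Tactic.RingSolver using () renaming (solve-∀ to ℤ-solve-∀)
open import Data.List using (List; []; _∷_; foldl)
open import Data.Maybe using (Maybe; just; nothing)
open import Data.Nat using (ℕ; zero; suc; _+_; _*_; _∸_; _<_; _≤_; z≤n; s≤s; _≡ᵇ_)
open import Data.Nat.Induction using (<-rec)
import Data.Nat.Properties as ℕ
open import Data.Nat.Tactic.RingSolver using () renaming (solve-∀ to ℕ-solve-∀)
open import Data.Product using (_,_; ∃-syntax)
open import Data.Sum using (_⊎_; inj₁; inj₂)
open import Function using (case_of_)
open import Relation.Binary.Bundles using (Setoid)
open import Relation.Binary.Structures using (IsEquivalence)
open import Relation.Binary.PropositionalEquality
  using (_≡_; _≢_; refl; sym; trans; cong; cong₂; subst; module ≡-Reasoning)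
import Relation.Binary.Reasoning.Setoid as SetoidReasoning
open import Relation.Nullary using (¬_; yes; no)
open import Tactic.RingSolver.Core.AlmostCommutativeRing using (fromCommutativeRing)
open import Tactic.RingSolver.Core.Expression using (Expr)

m≡k+b⇒m∸k≡b : ∀ k {m b} → m ≡ k + b → m ∸ k ≡ b
m≡k+b⇒m∸k≡b k {b = b} refl = ℕ.m+n∸m≡n k b

k≤Tk : ∀ k → k ≤ T k
k≤Tk zero    = z≤n
k≤Tk (suc k) = ℕ.m≤n+m (suc k) (T k)

Σ<-cong : ∀ n {f g : ℕ → ℤ} → (∀ i → i < n → f i ≡ g i) → Σ< n f ≡ Σ< n g
Σ<-cong zero    f≡g = refl
Σ<-cong (suc n) f≡g = cong₂ _+ℤ_ (Σ<-cong n λ i i<n → f≡g i (ℕ.m<n⇒m<1+n i<n)) (f≡g n ℕ.≤-refl)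

Σ<-head : ∀ n (f : ℕ → ℤ) → Σ< (suc n) f ≡ f 0 +ℤ Σ< n (λ i → f (suc i))
Σ<-head zero    f = trans (ℤ.+-identityˡ (f 0)) (sym (ℤ.+-identityʳ (f 0)))
Σ<-head (suc n) f = trans (cong (_+ℤ f (suc n)) (Σ<-head n f)) (ℤ.+-assoc (f 0) _ _)

Σ<-distrib-+ : ∀ n (f g : ℕ → ℤ) → Σ< n (λ i → f i +ℤ g i) ≡ Σ< n f +ℤ Σ< n g
Σ<-distrib-+ zero    f g = refl
Σ<-distrib-+ (suc n) f g =
  trans (cong (_+ℤ (f n +ℤ g n)) (Σ<-distrib-+ n f g)) (+-interchange (Σ< n f) (Σ< n g) (f n) (g n))
  where
  +-interchange : ∀ a b c d → (a +ℤ b) +ℤ (c +ℤ d) ≡ (a +ℤ c) +ℤ (b +ℤ d)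
  +-interchange = ℤ-solve-∀

Σ<-*ˡ : ∀ n c (f : ℕ → ℤ) → Σ< n (λ i → c *ℤ f i) ≡ c *ℤ Σ< n f
Σ<-*ˡ zero    c f = sym (ℤ.*-zeroʳ c)
Σ<-*ˡ (suc n) c f = trans (cong (_+ℤ c *ℤ f n) (Σ<-*ˡ n c f)) (sym (ℤ.*-distribˡ-+ c (Σ< n f) (f n)))

Σ<-neg : ∀ n (f : ℕ → ℤ) → Σ< n (λ i → -ℤ f i) ≡ -ℤ Σ< n f
Σ<-neg zero    f = refl
Σ<-neg (suc n) f = trans (cong (_+ℤ -ℤ f n) (Σ<-neg n f)) (sym (ℤ.neg-distrib-+ (Σ< n f) (f n)))

Σ<-zero : ∀ n → Σ< n (λ _ → 0ℤ) ≡ 0ℤ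
Σ<-zero zero    = refl
Σ<-zero (suc n) = cong (_+ℤ 0ℤ) (Σ<-zero n)

Σ<-reverse : ∀ n (f : ℕ → ℤ) → Σ< n f ≡ Σ< n (λ i → f (n ∸ suc i))
Σ<-reverse zero    f = refl
Σ<-reverse (suc n) f = begin
  Σ< n f +ℤ f n                           ≡⟨ cong (_+ℤ f n) (Σ<-reverse n f) ⟩
  Σ< n (λ i → f (n ∸ suc i)) +ℤ f n       ≡⟨ ℤ.+-comm _ (f n) ⟩
  f n +ℤ Σ< n (λ i → f (n ∸ suc i))       ≡⟨ Σ<-head n (λ i → f (suc n ∸ suc i)) ⟨
  Σ< (suc n) (λ i → f (suc n ∸ suc i))    ∎
  where open ≡-Reasoning

-- Formal power series

infix  4 _≈_
infix  8 -ˢ_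
infixl 6 _+ˢ_ _-ˢ_
infixr 8 _·ˢ_

record _≈_ (f g : PS) : Set where
  constructor coeffwise
  field coeff : ∀ k → f k ≡ g k
open _≈_ public

_+ˢ_ : PS → PS → PS
(f +ˢ g) k = f k +ℤ g k

-ˢ_ : PS → PS
(-ˢ f) k = -ℤ f k

_-ˢ_ : PS → PS → PS
f -ˢ g = f +ˢ -ˢ g

0ˢ : PS
0ˢ _ = 0ℤ

const : ℤ → PS
const c zero    = c
const c (suc _) = 0ℤ

_·ˢ_ : ℤ → PS → PS
(c ·ˢ f) k = c *ℤ f k

tail : PS → PS
tail f k = f (suc k)

≈-isEquivalence : IsEquivalence _≈_
≈-isEquivalence = record
  { refl  = coeffwise λ _ → refl
  ; sym   = λ p → coeffwise λ k → sym (coeff p k)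
  ; trans = λ p q → coeffwise λ k → trans (coeff p k) (coeff q k)
  }

≈-setoid : Setoid 0ℓ 0ℓ
≈-setoid = record { isEquivalence = ≈-isEquivalence }

open IsEquivalence ≈-isEquivalence public
  using () renaming (refl to ≈-refl; sym to ≈-sym; trans to ≈-trans; reflexive to ≈-reflexive)

module ≈-Reasoning = SetoidReasoning ≈-setoid

+ˢ-cong : ∀ {f f′ g g′} → f ≈ f′ → g ≈ g′ → f +ˢ g ≈ f′ +ˢ g′
+ˢ-cong p q = coeffwise λ k → cong₂ _+ℤ_ (coeff p k) (coeff q k)

-ˢ-cong : ∀ {f f′} → f ≈ f′ → -ˢ f ≈ -ˢ f′
-ˢ-cong p = coeffwise λ k → cong -ℤ_ (coeff p k)

⊛-cong : ∀ {f f′ g g′} → f ≈ f′ → g ≈ g′ → f ⊛ g ≈ f′ ⊛ g′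
⊛-cong p q = coeffwise λ k → Σ<-cong (suc k) λ i _ → cong₂ _*ℤ_ (coeff p i) (coeff q (k ∸ i))

-- The fixed operand is explicit: it cannot be inferred, since f ⊛ g unfolds to a λ-term.
+ˢ-congˡ : ∀ f {g g′} → g ≈ g′ → f +ˢ g ≈ f +ˢ g′
+ˢ-congˡ f p = +ˢ-cong {f} ≈-refl p

-ˢ-congˡ : ∀ f {g g′} → g ≈ g′ → f -ˢ g ≈ f -ˢ g′
-ˢ-congˡ f p = +ˢ-congˡ f (-ˢ-cong p)

⊛-congˡ : ∀ f {g g′} → g ≈ g′ → f ⊛ g ≈ f ⊛ g′
⊛-congˡ f = ⊛-cong {f} ≈-refl

⊛-congʳ : ∀ g {f f′} → f ≈ f′ → f ⊛ g ≈ f′ ⊛ g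
⊛-congʳ g p = ⊛-cong {g = g} p ≈-refl

⊛-at-0 : ∀ f g → (f ⊛ g) 0 ≡ f 0 *ℤ g 0
⊛-at-0 f g = ℤ.+-identityˡ _

⊛-at-suc : ∀ f g k → (f ⊛ g) (suc k) ≡ f 0 *ℤ g (suc k) +ℤ (tail f ⊛ g) k
⊛-at-suc f g k = Σ<-head (suc k) (λ i → f i *ℤ g (suc k ∸ i))

⊛-comm : ∀ f g → f ⊛ g ≈ g ⊛ f
⊛-comm f g = coeffwise λ k → trans (Σ<-reverse (suc k) _) (Σ<-cong (suc k) λ i i≤k →
  trans (ℤ.*-comm (f (k ∸ i)) _) (cong (λ j → g j *ℤ f (k ∸ i)) (ℕ.m∸[m∸n]≡n (ℕ.≤-pred i≤k))))

⊛-distribʳ : ∀ h f g → (f +ˢ g) ⊛ h ≈ f ⊛ h +ˢ g ⊛ h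
⊛-distribʳ h f g = coeffwise λ k →
  trans (Σ<-cong (suc k) λ i _ → ℤ.*-distribʳ-+ (h (k ∸ i)) (f i) (g i)) (Σ<-distrib-+ (suc k) _ _)

⊛-zeroˡ : ∀ f → 0ˢ ⊛ f ≈ 0ˢ
⊛-zeroˡ f = coeffwise λ k → trans (Σ<-cong (suc k) λ i _ → ℤ.*-zeroˡ (f (k ∸ i))) (Σ<-zero (suc k))

⊛-identityˡ : ∀ f → one ⊛ f ≈ f
⊛-identityˡ f = coeffwise λ where
  zero    → trans (⊛-at-0 one f) (ℤ.*-identityˡ (f 0))
  (suc k) → trans (⊛-at-suc one f k)
    (trans (cong₂ _+ℤ_ (ℤ.*-identityˡ (f (suc k))) (coeff (⊛-zeroˡ f) k)) (ℤ.+-identityʳ _))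

-ˢ-distribˡ-⊛ : ∀ f g → (-ˢ f) ⊛ g ≈ -ˢ (f ⊛ g)
-ˢ-distribˡ-⊛ f g = coeffwise λ k →
  trans (Σ<-cong (suc k) λ i _ → sym (ℤ.neg-distribˡ-* (f i) (g (k ∸ i)))) (Σ<-neg (suc k) _)

tail-⊛ : ∀ f g → tail (f ⊛ g) ≈ f 0 ·ˢ tail g +ˢ tail f ⊛ g
tail-⊛ f g = coeffwise (⊛-at-suc f g)

·ˢ-⊛ : ∀ c f g → (c ·ˢ f) ⊛ g ≈ c ·ˢ (f ⊛ g)
·ˢ-⊛ c f g = coeffwise λ k →
  trans (Σ<-cong (suc k) λ i _ → ℤ.*-assoc c (f i) (g (k ∸ i))) (Σ<-*ˡ (suc k) c _)

⊛-assoc : ∀ f g h → (f ⊛ g) ⊛ h ≈ f ⊛ (g ⊛ h)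
⊛-assoc f g h = coeffwise (assoc-at f g h)
  where
  regroup : ∀ a b c d e → a *ℤ b *ℤ c +ℤ (a *ℤ d +ℤ e) ≡ a *ℤ (b *ℤ c +ℤ d) +ℤ e
  regroup = ℤ-solve-∀
  assoc-at : ∀ f g h k → ((f ⊛ g) ⊛ h) k ≡ (f ⊛ (g ⊛ h)) k
  assoc-at f g h zero = begin
    ((f ⊛ g) ⊛ h) 0       ≡⟨ ⊛-at-0 (f ⊛ g) h ⟩
    (f ⊛ g) 0 *ℤ h 0      ≡⟨ cong (_*ℤ h 0) (⊛-at-0 f g) ⟩
    f 0 *ℤ g 0 *ℤ h 0     ≡⟨ ℤ.*-assoc (f 0) (g 0) (h 0) ⟩
    f 0 *ℤ (g 0 *ℤ h 0)   ≡⟨ cong (f 0 *ℤ_) (⊛-at-0 g h) ⟨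
    f 0 *ℤ (g ⊛ h) 0      ≡⟨ ⊛-at-0 f (g ⊛ h) ⟨
    (f ⊛ (g ⊛ h)) 0       ∎
    where open ≡-Reasoning
  assoc-at f g h (suc k) = begin
    ((f ⊛ g) ⊛ h) (suc k)
      ≡⟨ ⊛-at-suc (f ⊛ g) h k ⟩
    (f ⊛ g) 0 *ℤ h (suc k) +ℤ (tail (f ⊛ g) ⊛ h) k
      ≡⟨ cong₂ _+ℤ_ (cong (_*ℤ h (suc k)) (⊛-at-0 f g)) (coeff split-tail k) ⟩
    f 0 *ℤ g 0 *ℤ h (suc k) +ℤ (f 0 *ℤ (tail g ⊛ h) k +ℤ ((tail f ⊛ g) ⊛ h) k)
      ≡⟨ cong (λ x → f 0 *ℤ g 0 *ℤ h (suc k) +ℤ (f 0 *ℤ (tail g ⊛ h) k +ℤ x)) (assoc-at (tail f) g h k) ⟩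
    f 0 *ℤ g 0 *ℤ h (suc k) +ℤ (f 0 *ℤ (tail g ⊛ h) k +ℤ (tail f ⊛ (g ⊛ h)) k)
      ≡⟨ regroup (f 0) (g 0) (h (suc k)) _ _ ⟩
    f 0 *ℤ (g 0 *ℤ h (suc k) +ℤ (tail g ⊛ h) k) +ℤ (tail f ⊛ (g ⊛ h)) k
      ≡⟨ cong (λ x → f 0 *ℤ x +ℤ (tail f ⊛ (g ⊛ h)) k) (⊛-at-suc g h k) ⟨
    f 0 *ℤ (g ⊛ h) (suc k) +ℤ (tail f ⊛ (g ⊛ h)) k
      ≡⟨ ⊛-at-suc f (g ⊛ h) k ⟨
    (f ⊛ (g ⊛ h)) (suc k) ∎
    where
    open ≡-Reasoning
    split-tail : tail (f ⊛ g) ⊛ h ≈ f 0 ·ˢ (tail g ⊛ h) +ˢ (tail f ⊛ g) ⊛ h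
    split-tail = ≈-trans (⊛-congʳ h (tail-⊛ f g))
      (≈-trans (⊛-distribʳ h (f 0 ·ˢ tail g) (tail f ⊛ g))
               (+ˢ-cong {g = (tail f ⊛ g) ⊛ h} (·ˢ-⊛ (f 0) (tail g) h) ≈-refl))

⊛-identityʳ : ∀ f → f ⊛ one ≈ f
⊛-identityʳ f = ≈-trans (⊛-comm f one) (⊛-identityˡ f)

⊛-distribˡ : ∀ h f g → h ⊛ (f +ˢ g) ≈ h ⊛ f +ˢ h ⊛ g
⊛-distribˡ h f g = ≈-trans (⊛-comm h (f +ˢ g))
  (≈-trans (⊛-distribʳ h f g) (+ˢ-cong (⊛-comm f h) (⊛-comm g h)))

isCommutativeRing : IsCommutativeRing _≈_ _+ˢ_ _⊛_ -ˢ_ 0ˢ one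
isCommutativeRing = record
  { isRing = record
    { +-isAbelianGroup = record
      { isGroup = record
        { isMonoid = record
          { isSemigroup = record
            { isMagma = record { isEquivalence = ≈-isEquivalence ; ∙-cong = +ˢ-cong }
            ; assoc   = λ f g h → coeffwise λ k → ℤ.+-assoc (f k) (g k) (h k) }
          ; identity = (λ f → coeffwise λ k → ℤ.+-identityˡ (f k))
                     , (λ f → coeffwise λ k → ℤ.+-identityʳ (f k)) }
        ; inverse = (λ f → coeffwise λ k → ℤ.+-inverseˡ (f k))
                  , (λ f → coeffwise λ k → ℤ.+-inverseʳ (f k))
        ; ⁻¹-cong = -ˢ-cong }
      ; comm = λ f g → coeffwise λ k → ℤ.+-comm (f k) (g k) }
    ; *-cong     = ⊛-cong
    ; *-assoc    = ⊛-assoc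
    ; *-identity = ⊛-identityˡ , ⊛-identityʳ
    ; distrib    = ⊛-distribˡ , ⊛-distribʳ }
  ; *-comm = ⊛-comm }

commutativeRing : CommutativeRing 0ℓ 0ℓ
commutativeRing = record { isCommutativeRing = isCommutativeRing }

open CommutativeRing commutativeRing public
  using () renaming (+-identityˡ to +ˢ-identityˡ; +-identityʳ to +ˢ-identityʳ; zeroʳ to ⊛-zeroʳ)

⊛-coeff-zero : ∀ f g k → (∀ i → i ≤ k → f i ≡ 0ℤ ⊎ g (k ∸ i) ≡ 0ℤ) → (f ⊛ g) k ≡ 0ℤ
⊛-coeff-zero f g k one-vanishes = trans (Σ<-cong (suc k) term-zero) (Σ<-zero (suc k))
  where
  term-zero : ∀ i → i < suc k → f i *ℤ g (k ∸ i) ≡ 0ℤ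
  term-zero i i<1+k with one-vanishes i (ℕ.≤-pred i<1+k)
  ... | inj₁ fᵢ≡0 = trans (cong (_*ℤ g (k ∸ i)) fᵢ≡0) (ℤ.*-zeroˡ (g (k ∸ i)))
  ... | inj₂ gⱼ≡0 = trans (cong (f i *ℤ_) gⱼ≡0) (ℤ.*-zeroʳ (f i))

Σˢ : ℕ → (ℕ → PS) → PS
Σˢ N u k = Σ< N (λ n → u n k)

-- Carrier for the ring solver: integer literals stay visible, so that cancelling coefficients are
-- recognised although equality of series is undecidable. The literal 1 denotes `one` itself, so
-- that solved equations mention `one`.
data LitPS : Set where
  lit : ℤ → LitPS
  ps  : PS → LitPS

⟦_⟧ : LitPS → PS
⟦ lit (+ 1) ⟧ = one
⟦ lit c     ⟧ = const c
⟦ ps f      ⟧ = f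

infixl 6 _+ᴸ_
infixl 7 _*ᴸ_

_+ᴸ_ : LitPS → LitPS → LitPS
lit a +ᴸ lit b = lit (a +ℤ b)
x     +ᴸ y     = ps (⟦ x ⟧ +ˢ ⟦ y ⟧)

_*ᴸ_ : LitPS → LitPS → LitPS
lit a *ᴸ lit b = lit (a *ℤ b)
x     *ᴸ y     = ps (⟦ x ⟧ ⊛ ⟦ y ⟧)

-ᴸ_ : LitPS → LitPS
-ᴸ lit a = lit (-ℤ a)
-ᴸ x     = ps (-ˢ ⟦ x ⟧)

LitPS-rawRing : RawRing 0ℓ 0ℓ
LitPS-rawRing = record
  { Carrier = LitPS ; _≈_ = λ x y → ⟦ x ⟧ ≈ ⟦ y ⟧
  ; _+_ = _+ᴸ_ ; _*_ = _*ᴸ_ ; -_ = -ᴸ_ ; 0# = lit 0ℤ ; 1# = lit 1ℤ }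

⟦lit⟧ : ∀ c → ⟦ lit c ⟧ ≈ const c
⟦lit⟧ (+ 1) = coeffwise λ { zero → refl ; (suc k) → refl }
⟦lit⟧ (+ 0) = ≈-refl
⟦lit⟧ (+ suc (suc _)) = ≈-refl
⟦lit⟧ -[1+ _ ]        = ≈-refl

const-+ : ∀ a b → const (a +ℤ b) ≈ const a +ˢ const b
const-+ a b = coeffwise λ { zero → refl ; (suc k) → refl }

const-* : ∀ a b → const (a *ℤ b) ≈ const a ⊛ const b
const-* a b = coeffwise λ where
  zero    → sym (⊛-at-0 (const a) (const b))
  (suc k) → sym (trans (⊛-at-suc (const a) (const b) k)
                  (cong₂ _+ℤ_ (ℤ.*-zeroʳ a) (coeff (⊛-zeroˡ (const b)) k)))

const-neg : ∀ a → const (-ℤ a) ≈ -ˢ const a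
const-neg a = coeffwise λ { zero → refl ; (suc k) → refl }

⟦+ᴸ⟧ : ∀ x y → ⟦ x +ᴸ y ⟧ ≈ ⟦ x ⟧ +ˢ ⟦ y ⟧
⟦+ᴸ⟧ (lit a) (lit b) = ≈-trans (⟦lit⟧ (a +ℤ b))
  (≈-trans (const-+ a b) (≈-sym (+ˢ-cong (⟦lit⟧ a) (⟦lit⟧ b))))
⟦+ᴸ⟧ (lit a) (ps g)  = ≈-refl
⟦+ᴸ⟧ (ps f)  y       = ≈-refl

⟦*ᴸ⟧ : ∀ x y → ⟦ x *ᴸ y ⟧ ≈ ⟦ x ⟧ ⊛ ⟦ y ⟧
⟦*ᴸ⟧ (lit a) (lit b) = ≈-trans (⟦lit⟧ (a *ℤ b))
  (≈-trans (const-* a b) (≈-sym (⊛-cong (⟦lit⟧ a) (⟦lit⟧ b))))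
⟦*ᴸ⟧ (lit a) (ps g)  = ≈-refl
⟦*ᴸ⟧ (ps f)  y       = ≈-refl

⟦-ᴸ⟧ : ∀ x → ⟦ -ᴸ x ⟧ ≈ -ˢ ⟦ x ⟧
⟦-ᴸ⟧ (lit a) = ≈-trans (⟦lit⟧ (-ℤ a)) (≈-trans (const-neg a) (-ˢ-cong (≈-sym (⟦lit⟧ a))))
⟦-ᴸ⟧ (ps f)  = ≈-refl

⟦⟧-isRingMonomorphism : IsRingMonomorphism LitPS-rawRing (CommutativeRing.rawRing commutativeRing) ⟦_⟧
⟦⟧-isRingMonomorphism = record
  { isRingHomomorphism = record
    { isSemiringHomomorphism = record
      { isNearSemiringHomomorphism = record
        { +-isMonoidHomomorphism = record
          { isMagmaHomomorphism = record
            { isRelHomomorphism = record { cong = λ p → p }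
            ; homo = ⟦+ᴸ⟧ }
          ; ε-homo = coeffwise λ { zero → refl ; (suc k) → refl } }
        ; *-homo = ⟦*ᴸ⟧ }
      ; 1#-homo = ≈-refl }
    ; -‿homo = ⟦-ᴸ⟧ }
  ; injective = λ p → p }

LitPS-commutativeRing : CommutativeRing 0ℓ 0ℓ
LitPS-commutativeRing = record
  { isCommutativeRing = RingMonomorphism.isCommutativeRing ⟦⟧-isRingMonomorphism isCommutativeRing }

lit-0≟ : ∀ x → Maybe (⟦ lit 0ℤ ⟧ ≈ ⟦ x ⟧)
lit-0≟ (lit c) with 0ℤ ℤ.≟ c
... | yes refl = just ≈-refl
... | no _     = nothing
lit-0≟ (ps f) = nothing

open import Tactic.RingSolver.NonReflective (fromCommutativeRing LitPS-commutativeRing lit-0≟) public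
  using (solve; _⊜_; Κ; _⊕_; _⊗_; ⊝_)

1ₑ : ∀ {n} → Expr LitPS n
1ₑ = Κ (lit 1ℤ)

⊛-distribʳ-diff : ∀ F₁ m F₀ Z → (F₁ -ˢ m ⊛ F₀) ⊛ Z ≈ F₁ ⊛ Z -ˢ m ⊛ (F₀ ⊛ Z)
⊛-distribʳ-diff F₁ m F₀ Z =
  solve 4 (λ F₁ m F₀ Z → (F₁ ⊕ ⊝ (m ⊗ F₀)) ⊗ Z ⊜ (F₁ ⊗ Z ⊕ ⊝ (m ⊗ (F₀ ⊗ Z))))
        ≈-refl (ps F₁) (ps m) (ps F₀) (ps Z)

-- Congruence modulo powers of q

infix 4 _≈[_]_

-- f ≈[ s ] g means f ≡ g (mod q^s).
record _≈[_]_ (f : PS) (s : ℕ) (g : PS) : Set where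
  constructor coeffwise<
  field coeff< : ∀ k → k < s → f k ≡ g k
open _≈[_]_ public

≈[]-isEquivalence : ∀ s → IsEquivalence (λ f g → f ≈[ s ] g)
≈[]-isEquivalence s = record
  { refl  = coeffwise< λ _ _ → refl
  ; sym   = λ p → coeffwise< λ k k<s → sym (coeff< p k k<s)
  ; trans = λ p q → coeffwise< λ k k<s → trans (coeff< p k k<s) (coeff< q k k<s)
  }

≈[]-setoid : ℕ → Setoid 0ℓ 0ℓ
≈[]-setoid s = record { isEquivalence = ≈[]-isEquivalence s }

module ≈[]-Reasoning (s : ℕ) = SetoidReasoning (≈[]-setoid s)

module _ {s : ℕ} where
  open IsEquivalence (≈[]-isEquivalence s) public
    using () renaming (refl to ≈[]-refl; trans to ≈[]-trans)

≈⇒≈[] : ∀ {f g s} → f ≈ g → f ≈[ s ] g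
≈⇒≈[] p = coeffwise< λ k _ → coeff p k

≈[]-weaken : ∀ {f g s t} → t ≤ s → f ≈[ s ] g → f ≈[ t ] g
≈[]-weaken t≤s p = coeffwise< λ k k<t → coeff< p k (ℕ.<-≤-trans k<t t≤s)

≈[suc]⇒≈ : ∀ {f g} → (∀ k → f ≈[ suc k ] g) → f ≈ g
≈[suc]⇒≈ p = coeffwise λ k → coeff< (p k) k ℕ.≤-refl

+ˢ-cong[] : ∀ {f f′ g g′ s} → f ≈[ s ] f′ → g ≈[ s ] g′ → f +ˢ g ≈[ s ] f′ +ˢ g′
+ˢ-cong[] p q = coeffwise< λ k k<s → cong₂ _+ℤ_ (coeff< p k k<s) (coeff< q k k<s)

⊛-cong[] : ∀ {f f′ g g′ s} → f ≈[ s ] f′ → g ≈[ s ] g′ → f ⊛ g ≈[ s ] f′ ⊛ g′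
⊛-cong[] p q = coeffwise< λ k k<s → Σ<-cong (suc k) λ i i≤k →
  cong₂ _*ℤ_ (coeff< p i (ℕ.≤-<-trans (ℕ.≤-pred i≤k) k<s))
             (coeff< q (k ∸ i) (ℕ.≤-<-trans (ℕ.m∸n≤m k i) k<s))

unit⊛≈[]0⇒≈[]0 : ∀ {A D s} → A 0 ≡ 1ℤ → A ⊛ D ≈[ s ] 0ˢ → D ≈[ s ] 0ˢ
unit⊛≈[]0⇒≈[]0 {A} {D} {s} A₀≡1 AD≈0 = coeffwise< (<-rec (λ k → k < s → D k ≡ 0ℤ) step)
  where
  step : ∀ k → (∀ {j} → j < k → j < s → D j ≡ 0ℤ) → k < s → D k ≡ 0ℤ
  step k lower k<s = begin
    D k                                                  ≡⟨ ℤ.*-identityˡ (D k) ⟨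
    1ℤ *ℤ D k                                            ≡⟨ ℤ.+-identityʳ _ ⟨
    1ℤ *ℤ D k +ℤ 0ℤ                                      ≡⟨ cong₂ _+ℤ_ (cong (_*ℤ D k) A₀≡1) higher-terms ⟨
    A 0 *ℤ D k +ℤ Σ< k (λ i → A (suc i) *ℤ D (k ∸ suc i)) ≡⟨ Σ<-head k (λ i → A i *ℤ D (k ∸ i)) ⟨
    (A ⊛ D) k                                            ≡⟨ coeff< AD≈0 k k<s ⟩
    0ℤ                                                   ∎
    where
    open ≡-Reasoning
    higher-terms : Σ< k (λ i → A (suc i) *ℤ D (k ∸ suc i)) ≡ 0ℤ
    higher-terms = trans (Σ<-cong k λ i i<k →
        trans (cong (A (suc i) *ℤ_) (lower (ℕ.∸-monoʳ-< (s≤s z≤n) i<k)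
                                            (ℕ.≤-<-trans (ℕ.m∸n≤m k (suc i)) k<s)))
              (ℤ.*-zeroʳ (A (suc i))))
      (Σ<-zero k)

⊛-cancelʳ[] : ∀ {A W V s} → A 0 ≡ 1ℤ → W ⊛ A ≈[ s ] V ⊛ A → W ≈[ s ] V
⊛-cancelʳ[] {A} {W} {V} {s} A₀≡1 WA≈VA = coeffwise< λ k k<s →
  ℤ.i-j≡0⇒i≡j (W k) (V k) (coeff< (unit⊛≈[]0⇒≈[]0 {A} {W -ˢ V} A₀≡1 A[W-V]≈0) k k<s)
  where
  A[W-V]≈0 : A ⊛ (W -ˢ V) ≈[ s ] 0ˢ
  A[W-V]≈0 = coeffwise< λ k k<s → begin
    (A ⊛ (W -ˢ V)) k             ≡⟨ coeff (⊛-comm A (W -ˢ V)) k ⟩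
    ((W -ˢ V) ⊛ A) k             ≡⟨ coeff (⊛-distribʳ A W (-ˢ V)) k ⟩
    (W ⊛ A) k +ℤ ((-ˢ V) ⊛ A) k  ≡⟨ cong₂ _+ℤ_ (coeff< WA≈VA k k<s) (coeff (-ˢ-distribˡ-⊛ V A) k) ⟩
    (V ⊛ A) k +ℤ -ℤ (V ⊛ A) k    ≡⟨ ℤ.+-inverseʳ ((V ⊛ A) k) ⟩
    0ℤ                           ∎
    where open ≡-Reasoning

⊛-cancelʳ : ∀ {A W V} → A 0 ≡ 1ℤ → W ⊛ A ≈ V ⊛ A → W ≈ V
⊛-cancelʳ {A} A₀≡1 WA≈VA = ≈[suc]⇒≈ λ _ → ⊛-cancelʳ[] {A} A₀≡1 (≈⇒≈[] WA≈VA)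

Σˢ-cong[] : ∀ {s} N {u v} → (∀ n → n < N → u n ≈[ s ] v n) → Σˢ N u ≈[ s ] Σˢ N v
Σˢ-cong[] zero    uₙ≈vₙ = ≈[]-refl
Σˢ-cong[] (suc N) uₙ≈vₙ =
  +ˢ-cong[] (Σˢ-cong[] N λ n n<N → uₙ≈vₙ n (ℕ.m<n⇒m<1+n n<N)) (uₙ≈vₙ N ℕ.≤-refl)

q^ : ℕ → PS
q^ e = shift e one

shift-suc : ∀ n f k → shift (suc n) f (suc k) ≡ shift n f k
shift-suc zero    f k = refl
shift-suc (suc n) f k = refl

shift-≈[] : ∀ e {f g s} → f ≈[ s ] g → shift e f ≈[ e + s ] shift e g
shift-≈[] zero    p = p
shift-≈[] (suc e) {f} {g} p = coeffwise< λ where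
  zero    _         → refl
  (suc k) (s≤s k<s) → trans (shift-suc e f k)
                        (trans (coeff< (shift-≈[] e p) k k<s) (sym (shift-suc e g k)))

shift-⊛ : ∀ e f → shift e f ≈ q^ e ⊛ f
shift-⊛ zero    f = ≈-sym (⊛-identityˡ f)
shift-⊛ (suc e) f = coeffwise at
  where
  open ≡-Reasoning
  at : ∀ k → shift (suc e) f k ≡ (q^ (suc e) ⊛ f) k
  at zero    = sym (trans (⊛-at-0 (q^ (suc e)) f) (ℤ.*-zeroˡ (f 0)))
  at (suc k) = begin
    shift (suc e) f (suc k)                    ≡⟨ shift-suc e f k ⟩
    shift e f k                                ≡⟨ coeff (shift-⊛ e f) k ⟩
    (q^ e ⊛ f) k                               ≡⟨ coeff (⊛-congʳ f (coeffwise (shift-suc e one))) k ⟨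
    (tail x ⊛ f) k                             ≡⟨ ℤ.+-identityˡ _ ⟨
    0ℤ +ℤ (tail x ⊛ f) k                       ≡⟨ cong (_+ℤ (tail x ⊛ f) k) (ℤ.*-zeroˡ (f (suc k))) ⟨
    0ℤ *ℤ f (suc k) +ℤ (tail x ⊛ f) k          ≡⟨ ⊛-at-suc x f k ⟨
    (x ⊛ f) (suc k)                            ∎
    where x = q^ (suc e)

q^-⊛-≈[] : ∀ e {f g s} → f ≈[ s ] g → q^ e ⊛ f ≈[ e + s ] q^ e ⊛ g
q^-⊛-≈[] e {f} {g} {s} p = begin
  q^ e ⊛ f    ≈⟨ ≈⇒≈[] (shift-⊛ e f) ⟨
  shift e f   ≈⟨ shift-≈[] e p ⟩
  shift e g   ≈⟨ ≈⇒≈[] (shift-⊛ e g) ⟩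
  q^ e ⊛ g    ∎
  where open ≈[]-Reasoning (e + s)

q^-⊛-≈[]-0 : ∀ e f → q^ e ⊛ f ≈[ e ] 0ˢ
q^-⊛-≈[]-0 e f = ≈[]-weaken (ℕ.m≤m+n e 0)
  (≈[]-trans (q^-⊛-≈[] e {f} {0ˢ} (coeffwise< λ _ ())) (≈⇒≈[] (⊛-zeroʳ (q^ e))))

shift-shift : ∀ a b f → shift a (shift b f) ≈ shift (a + b) f
shift-shift zero    b f = ≈-refl
shift-shift (suc a) b f = coeffwise λ where
  zero    → refl
  (suc k) → trans (shift-suc a (shift b f) k)
              (trans (coeff (shift-shift a b f) k) (sym (shift-suc (a + b) f k)))

q^-+ : ∀ a b → q^ (a + b) ≈ q^ a ⊛ q^ b
q^-+ a b = ≈-trans (≈-sym (shift-shift a b one)) (shift-⊛ a (q^ b))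

q^-coeff-≢ : ∀ {e k} → e ≢ k → q^ e k ≡ 0ℤ
q^-coeff-≢ {zero}  {zero}  e≢k = ⊥-elim (e≢k refl)
q^-coeff-≢ {zero}  {suc k} e≢k = refl
q^-coeff-≢ {suc e} {zero}  e≢k = refl
q^-coeff-≢ {suc e} {suc k} e≢k = trans (shift-suc e one k) (q^-coeff-≢ (λ e≡k → e≢k (cong suc e≡k)))

q^-≈[]-0 : ∀ e → q^ e ≈[ e ] 0ˢ
q^-≈[]-0 e = coeffwise< λ k k<e → q^-coeff-≢ (λ e≡k → ℕ.<-irrefl (sym e≡k) k<e)

indicator≡q^ : ∀ c e k → (if k ≡ᵇ e then c else 0ℤ) ≡ c *ℤ q^ e k
indicator≡q^ c zero    zero    = sym (ℤ.*-identityʳ c)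
indicator≡q^ c zero    (suc k) = sym (ℤ.*-zeroʳ c)
indicator≡q^ c (suc e) zero    = sym (ℤ.*-zeroʳ c)
indicator≡q^ c (suc e) (suc k) = trans (indicator≡q^ c e k) (cong (c *ℤ_) (sym (shift-suc e one k)))

oneMinus-1 : ∀ e → oneMinus 1ℤ e ≈ one -ˢ q^ e
oneMinus-1 e = coeffwise λ k →
  cong (λ x → one k +ℤ -ℤ x) (trans (indicator≡q^ 1ℤ e k) (ℤ.*-identityˡ (q^ e k)))

oneMinus-[-1] : ∀ e → oneMinus -1ℤ e ≈ one +ˢ q^ e
oneMinus-[-1] e = coeffwise λ k →
  trans (cong (λ x → one k +ℤ -ℤ x) (indicator≡q^ -1ℤ e k)) (minus-minus (one k) (q^ e k))
  where
  minus-minus : ∀ a x → a +ℤ -ℤ (-1ℤ *ℤ x) ≡ a +ℤ x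
  minus-minus = ℤ-solve-∀

q^0⊛one⊛f≈f : ∀ f → q^ 0 ⊛ one ⊛ f ≈ f
q^0⊛one⊛f≈f f = ≈-trans (⊛-congʳ f (⊛-identityʳ (q^ 0))) (⊛-identityˡ f)

monomial : ℕ → List ℕ → PS
monomial e es = foldl (λ m f → m ⊛ q^ f) (q^ e) es

q^-monomial : ∀ e es {m} → foldl _+_ e es ≡ m → q^ m ≈ monomial e es
q^-monomial e es refl = ≈-sym (go e (q^ e) es ≈-refl)
  where
  go : ∀ e m es → m ≈ q^ e → foldl (λ m f → m ⊛ q^ f) m es ≈ q^ (foldl _+_ e es)
  go e m []       m≈q^e = m≈q^e
  go e m (f ∷ es) m≈q^e =
    go (e + f) (m ⊛ q^ f) es (≈-trans (⊛-congʳ (q^ f) m≈q^e) (≈-sym (q^-+ e f)))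

oneMinus-1-monomial : ∀ e es {m} → foldl _+_ e es ≡ m → oneMinus 1ℤ m ≈ one -ˢ monomial e es
oneMinus-1-monomial e es eq = ≈-trans (oneMinus-1 _) (-ˢ-congˡ one (q^-monomial e es eq))

oneMinus-1-⊛ : ∀ a b {e} → a + b ≡ e → oneMinus 1ℤ e ≈ one -ˢ q^ a ⊛ q^ b
oneMinus-1-⊛ a b = oneMinus-1-monomial a (b ∷ [])

oneMinus-≈[]-one : ∀ c e → oneMinus c e ≈[ e ] one
oneMinus-≈[]-one c e = coeffwise< λ k k<e → begin
  oneMinus c e k            ≡⟨ cong (one k −ℤ_) (indicator≡q^ c e k) ⟩
  one k −ℤ c *ℤ q^ e k      ≡⟨ cong (λ x → one k −ℤ c *ℤ x) (coeff< (q^-≈[]-0 e) k k<e) ⟩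
  one k −ℤ c *ℤ 0ℤ          ≡⟨ cong (one k −ℤ_) (ℤ.*-zeroʳ c) ⟩
  one k −ℤ 0ℤ               ≡⟨ ℤ.+-identityʳ (one k) ⟩
  one k                     ∎
  where open ≡-Reasoning

finProd-≈[]-one : ∀ {s} n f → (∀ j → j < n → f j ≈[ s ] one) → finProd n f ≈[ s ] one
finProd-≈[]-one zero    f fⱼ≈1 = ≈[]-refl
finProd-≈[]-one (suc n) f fⱼ≈1 = ≈[]-trans
  (⊛-cong[] (finProd-≈[]-one n f λ j j<n → fⱼ≈1 j (ℕ.m<n⇒m<1+n j<n)) (fⱼ≈1 n ℕ.≤-refl))
  (≈⇒≈[] (⊛-identityˡ one))

finProd-extend : ∀ {s} f {n n′} → n ≤ n′ → (∀ j → n ≤ j → f j ≈[ s ] one) →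
                 finProd n′ f ≈[ s ] finProd n f
finProd-extend {s} f {n} n≤n′ fⱼ≈1 with ℕ.m≤n⇒∃[o]m+o≡n n≤n′
... | d , n+d≡n′ =
  subst (λ n′ → finProd n′ f ≈[ s ] finProd n f) (trans (ℕ.+-comm d n) n+d≡n′) (extend d)
  where
  extend : ∀ d → finProd (d + n) f ≈[ s ] finProd n f
  extend zero    = ≈[]-refl
  extend (suc d) =
    ≈[]-trans (⊛-cong[] (extend d) (fⱼ≈1 (d + n) (ℕ.m≤n+m n d))) (≈⇒≈[] (⊛-identityʳ (finProd n f)))

finProd-at-0 : ∀ n f → (∀ j → f j ≈[ 1 ] one) → finProd n f 0 ≡ 1ℤ
finProd-at-0 n f fⱼ≈1 = coeff< (finProd-≈[]-one n f λ j _ → fⱼ≈1 j) 0 (s≤s z≤n)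

pochFin-≈[]-one : ∀ c m L → pochFin c m L ≈[ m ] one
pochFin-≈[]-one c m L = finProd-≈[]-one L _ λ j _ →
  ≈[]-weaken (ℕ.m≤m+n m j) (oneMinus-≈[]-one c (m + j))

pochFin-front : ∀ c m L → pochFin c m (suc L) ≈ oneMinus c m ⊛ pochFin c (suc m) L
pochFin-front c m zero = begin
  one ⊛ oneMinus c (m + 0)  ≈⟨ ⊛-identityˡ _ ⟩
  oneMinus c (m + 0)        ≡⟨ cong (oneMinus c) (ℕ.+-identityʳ m) ⟩
  oneMinus c m              ≈⟨ ⊛-identityʳ _ ⟨
  oneMinus c m ⊛ one        ∎
  where open ≈-Reasoning
pochFin-front c m (suc L) = begin
  pochFin c m (suc L) ⊛ oneMinus c (m + suc L)
    ≈⟨ ⊛-cong (pochFin-front c m L) (≈-reflexive (cong (oneMinus c) (ℕ.+-suc m L))) ⟩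
  oneMinus c m ⊛ pochFin c (suc m) L ⊛ oneMinus c (suc m + L)
    ≈⟨ ⊛-assoc (oneMinus c m) (pochFin c (suc m) L) (oneMinus c (suc m + L)) ⟩
  oneMinus c m ⊛ pochFin c (suc m) (suc L) ∎
  where open ≈-Reasoning

pochFin-extend : ∀ c m {L L′} → L ≤ L′ → pochFin c m L′ ≈[ m + L ] pochFin c m L
pochFin-extend c m L≤L′ = finProd-extend _ L≤L′ λ j L≤j →
  ≈[]-weaken (ℕ.+-monoʳ-≤ m L≤j) (oneMinus-≈[]-one c (m + j))

pochInf-≈[] : ∀ c m L → pochInf c m ≈[ m + L ] pochFin c m L
pochInf-≈[] c m L = coeffwise< λ k k<m+L → case ℕ.≤-total (suc k) L of λ where
  (inj₁ 1+k≤L) → sym (coeff< (pochFin-extend c m 1+k≤L) k (ℕ.m≤n+m (suc k) m))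
  (inj₂ L≤1+k) → coeff< (pochFin-extend c m L≤1+k) k k<m+L

pochInf-front : ∀ c m → pochInf c m ≈ oneMinus c m ⊛ pochInf c (suc m)
pochInf-front c m = ≈[suc]⇒≈ below
  where
  below : ∀ k → pochInf c m ≈[ suc k ] oneMinus c m ⊛ pochInf c (suc m)
  below k = begin
    pochInf c m
      ≈⟨ ≈[]-weaken (ℕ.m≤n+m (suc k) m) (pochInf-≈[] c m (suc k)) ⟩
    pochFin c m (suc k)
      ≈⟨ ≈⇒≈[] (pochFin-front c m k) ⟩
    oneMinus c m ⊛ pochFin c (suc m) k
      ≈⟨ ⊛-cong[] {oneMinus c m} ≈[]-refl (≈[]-weaken (s≤s (ℕ.m≤n+m k m)) (pochInf-≈[] c (suc m) k)) ⟨
    oneMinus c m ⊛ pochInf c (suc m) ∎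
    where open ≈[]-Reasoning (suc k)

-- The products Ψ m, and Euler's identity

ψ-factor : ℕ → PS
ψ-factor m = (one +ˢ q^ m) ⊛ (one +ˢ q^ m) ⊛ (one -ˢ q^ m)

Ψ : ℕ → PS
Ψ m = pochInf -1ℤ m ⊛ pochInf -1ℤ m ⊛ pochInf 1ℤ m

Ψ-front : ∀ m → Ψ m ≈ ψ-factor m ⊛ Ψ (suc m)
Ψ-front m = begin
  E m ⊛ E m ⊛ Q m
    ≈⟨ ⊛-cong (⊛-cong E-front E-front) Q-front ⟩
  ((one +ˢ x) ⊛ E (suc m)) ⊛ ((one +ˢ x) ⊛ E (suc m)) ⊛ ((one -ˢ x) ⊛ Q (suc m))
    ≈⟨ solve 3 (λ x e p → ((1ₑ ⊕ x) ⊗ e) ⊗ ((1ₑ ⊕ x) ⊗ e) ⊗ ((1ₑ ⊕ ⊝ x) ⊗ p)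
                        ⊜ (1ₑ ⊕ x) ⊗ (1ₑ ⊕ x) ⊗ (1ₑ ⊕ ⊝ x) ⊗ (e ⊗ e ⊗ p))
               ≈-refl (ps x) (ps (E (suc m))) (ps (Q (suc m))) ⟩
  ψ-factor m ⊛ Ψ (suc m) ∎
  where
  open ≈-Reasoning
  E = pochInf -1ℤ
  Q = pochInf 1ℤ
  x = q^ m
  E-front : E m ≈ (one +ˢ x) ⊛ E (suc m)
  E-front = ≈-trans (pochInf-front -1ℤ m) (⊛-congʳ (E (suc m)) (oneMinus-[-1] m))
  Q-front : Q m ≈ (one -ˢ x) ⊛ Q (suc m)
  Q-front = ≈-trans (pochInf-front 1ℤ m) (⊛-congʳ (Q (suc m)) (oneMinus-1 m))

ψ-factor-monomial : ∀ n e es → foldl _+_ e es ≡ n →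
  ψ-factor n ≈ (one +ˢ monomial e es) ⊛ (one +ˢ monomial e es) ⊛ (one -ˢ monomial e es)
ψ-factor-monomial n e es eq =
  ⊛-cong (⊛-cong (+ˢ-congˡ one x≈) (+ˢ-congˡ one x≈)) (-ˢ-congˡ one x≈)
  where x≈ = q^-monomial e es eq

Ψ-fin : ℕ → PS
Ψ-fin n = pochFin -1ℤ 1 n ⊛ pochFin -1ℤ 1 n ⊛ pochFin 1ℤ 1 n

Ψ-≈[]-Ψ-fin : ∀ n → Ψ 1 ≈[ suc n ] Ψ-fin n
Ψ-≈[]-Ψ-fin n = ⊛-cong[] (⊛-cong[] E≈ E≈) (pochInf-≈[] 1ℤ 1 n)
  where
  E≈ : pochInf -1ℤ 1 ≈[ suc n ] pochFin -1ℤ 1 n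
  E≈ = pochInf-≈[] -1ℤ 1 n

Ψ-fin-suc : ∀ n → Ψ-fin (suc n) ≈ Ψ-fin n ⊛ ψ-factor (suc n)
Ψ-fin-suc n = begin
  (E ⊛ oneMinus -1ℤ (suc n)) ⊛ (E ⊛ oneMinus -1ℤ (suc n)) ⊛ (Q ⊛ oneMinus 1ℤ (suc n))
    ≈⟨ ⊛-cong (⊛-cong E-step E-step) (⊛-congˡ Q (oneMinus-1 (suc n))) ⟩
  (E ⊛ (one +ˢ x)) ⊛ (E ⊛ (one +ˢ x)) ⊛ (Q ⊛ (one -ˢ x))
    ≈⟨ solve 3 (λ e p x → (e ⊗ (1ₑ ⊕ x)) ⊗ (e ⊗ (1ₑ ⊕ x)) ⊗ (p ⊗ (1ₑ ⊕ ⊝ x))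
                        ⊜ (e ⊗ e ⊗ p) ⊗ ((1ₑ ⊕ x) ⊗ (1ₑ ⊕ x) ⊗ (1ₑ ⊕ ⊝ x)))
               ≈-refl (ps E) (ps Q) (ps x) ⟩
  Ψ-fin n ⊛ ψ-factor (suc n) ∎
  where
  open ≈-Reasoning
  E = pochFin -1ℤ 1 n
  Q = pochFin 1ℤ 1 n
  x = q^ (suc n)
  E-step : E ⊛ oneMinus -1ℤ (suc n) ≈ E ⊛ (one +ˢ x)
  E-step = ⊛-congˡ E (oneMinus-[-1] (suc n))

oddPoch evenPoch : ℕ → PS
oddPoch  J = finProd J (λ i → oneMinus 1ℤ (suc (i + i)))
evenPoch J = finProd J (λ i → oneMinus 1ℤ (suc (suc (i + i))))

oneMinus-suc-≈[1]-one : ∀ c e → oneMinus c (suc e) ≈[ 1 ] one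
oneMinus-suc-≈[1]-one c e = ≈[]-weaken (s≤s z≤n) (oneMinus-≈[]-one c (suc e))

oddPoch-at-0 : ∀ J → oddPoch J 0 ≡ 1ℤ
oddPoch-at-0 J = finProd-at-0 J _ λ i → oneMinus-suc-≈[1]-one 1ℤ (i + i)

evenPoch-at-0 : ∀ J → evenPoch J 0 ≡ 1ℤ
evenPoch-at-0 J = finProd-at-0 J _ λ i → oneMinus-suc-≈[1]-one 1ℤ (suc (i + i))

evenPoch-extend : ∀ {J J′} → J ≤ J′ → evenPoch J′ ≈[ suc (J + J) ] evenPoch J
evenPoch-extend J≤J′ = finProd-extend _ J≤J′ λ j J≤j →
  ≈[]-weaken (s≤s (ℕ.≤-trans (ℕ.+-mono-≤ J≤j J≤j) (ℕ.n≤1+n (j + j))))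
             (oneMinus-≈[]-one 1ℤ (suc (suc (j + j))))

pochFin-[-1]⊛pochFin-1 : ∀ M → pochFin -1ℤ 1 M ⊛ pochFin 1ℤ 1 M ≈ evenPoch M
pochFin-[-1]⊛pochFin-1 zero    = ⊛-identityˡ one
pochFin-[-1]⊛pochFin-1 (suc M) = begin
  (E ⊛ oneMinus -1ℤ (suc M)) ⊛ (Q ⊛ oneMinus 1ℤ (suc M))
    ≈⟨ ⊛-cong (⊛-congˡ E (oneMinus-[-1] (suc M))) (⊛-congˡ Q (oneMinus-1 (suc M))) ⟩
  (E ⊛ (one +ˢ x)) ⊛ (Q ⊛ (one -ˢ x))
    ≈⟨ solve 3 (λ e p x → (e ⊗ (1ₑ ⊕ x)) ⊗ (p ⊗ (1ₑ ⊕ ⊝ x)) ⊜ (e ⊗ p) ⊗ (1ₑ ⊕ ⊝ (x ⊗ x)))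
               ≈-refl (ps E) (ps Q) (ps x) ⟩
  (E ⊛ Q) ⊛ (one -ˢ x ⊛ x)
    ≈⟨ ⊛-cong (pochFin-[-1]⊛pochFin-1 M)
              (≈-sym (oneMinus-1-⊛ (suc M) (suc M) (cong suc (ℕ.+-suc M M)))) ⟩
  evenPoch (suc M) ∎
  where
  open ≈-Reasoning
  E = pochFin -1ℤ 1 M
  Q = pochFin 1ℤ 1 M
  x = q^ (suc M)

pochFin-1-parity : ∀ J → pochFin 1ℤ 1 (J + J) ≈ oddPoch J ⊛ evenPoch J
pochFin-1-parity zero    = ≈-sym (⊛-identityˡ one)
pochFin-1-parity (suc J) = begin
  pochFin 1ℤ 1 (suc J + suc J)
    ≡⟨ cong (pochFin 1ℤ 1) (cong suc (ℕ.+-suc J J)) ⟩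
  pochFin 1ℤ 1 (J + J) ⊛ odd ⊛ even
    ≈⟨ ⊛-congʳ even (⊛-congʳ odd (pochFin-1-parity J)) ⟩
  oddPoch J ⊛ evenPoch J ⊛ odd ⊛ even
    ≈⟨ solve 4 (λ a b c d → a ⊗ b ⊗ c ⊗ d ⊜ (a ⊗ c) ⊗ (b ⊗ d))
               ≈-refl (ps (oddPoch J)) (ps (evenPoch J)) (ps odd) (ps even) ⟩
  oddPoch (suc J) ⊛ evenPoch (suc J) ∎
  where
  open ≈-Reasoning
  odd  = oneMinus 1ℤ (suc (J + J))
  even = oneMinus 1ℤ (suc (suc (J + J)))

oddPoch⊛pochFin-[-1] : ∀ J → oddPoch J ⊛ pochFin -1ℤ 1 (J + J) ≈[ suc (J + J) ] one
oddPoch⊛pochFin-[-1] J = ⊛-cancelʳ[] {evenPoch J} (evenPoch-at-0 J) (begin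
  (oddPoch J ⊛ E) ⊛ evenPoch J
    ≈⟨ ≈⇒≈[] (solve 3 (λ o e v → (o ⊗ e) ⊗ v ⊜ e ⊗ (o ⊗ v))
                       ≈-refl (ps (oddPoch J)) (ps E) (ps (evenPoch J))) ⟩
  E ⊛ (oddPoch J ⊛ evenPoch J)
    ≈⟨ ≈⇒≈[] (⊛-congˡ E (pochFin-1-parity J)) ⟨
  E ⊛ pochFin 1ℤ 1 (J + J)
    ≈⟨ ≈⇒≈[] (pochFin-[-1]⊛pochFin-1 (J + J)) ⟩
  evenPoch (J + J)
    ≈⟨ evenPoch-extend (ℕ.m≤m+n J J) ⟩
  evenPoch J
    ≈⟨ ≈⇒≈[] (⊛-identityˡ (evenPoch J)) ⟨
  one ⊛ evenPoch J ∎)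
  where
  open ≈[]-Reasoning (suc (J + J))
  E = pochFin -1ℤ 1 (J + J)

oddPoch⊛Ψ : ∀ J → oddPoch J ⊛ Ψ 1 ≈[ suc (J + J) ] evenPoch J
oddPoch⊛Ψ J = begin
  oddPoch J ⊛ Ψ 1
    ≈⟨ ⊛-cong[] {oddPoch J} ≈[]-refl (Ψ-≈[]-Ψ-fin (J + J)) ⟩
  oddPoch J ⊛ (E ⊛ E ⊛ Q)
    ≈⟨ ≈⇒≈[] (solve 3 (λ o e p → o ⊗ (e ⊗ e ⊗ p) ⊜ (o ⊗ e) ⊗ (e ⊗ p))
                       ≈-refl (ps (oddPoch J)) (ps E) (ps Q)) ⟩
  (oddPoch J ⊛ E) ⊛ (E ⊛ Q)
    ≈⟨ ⊛-cong[] (oddPoch⊛pochFin-[-1] J) (≈⇒≈[] (pochFin-[-1]⊛pochFin-1 (J + J))) ⟩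
  one ⊛ evenPoch (J + J)
    ≈⟨ ≈⇒≈[] (⊛-identityˡ _) ⟩
  evenPoch (J + J)
    ≈⟨ evenPoch-extend (ℕ.m≤m+n J J) ⟩
  evenPoch J ∎
  where
  open ≈[]-Reasoning (suc (J + J))
  E = pochFin -1ℤ 1 (J + J)
  Q = pochFin 1ℤ 1 (J + J)

-- Gauss's identity

gaussTerm : ℕ → ℕ → PS
gaussTerm n k = q^ (T k) ⊛ pochFin 1ℤ (suc n ∸ k) k ⊛ pochFin 1ℤ (suc (suc (n + k))) (n ∸ k)

-- Found by creative telescoping.
gaussCert : ℕ → ℕ → PS
gaussCert n zero    = 0ˢ
gaussCert n (suc k) =
  q^ (T k + suc n) ⊛ pochFin 1ℤ (suc n ∸ k) k ⊛ oneMinus 1ℤ (suc k)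
    ⊛ pochFin 1ℤ (suc (suc (suc (n + k)))) (n ∸ k)

gaussTerm-≈[]-q^T : ∀ n k → k ≤ n → gaussTerm n k ≈[ suc n ] q^ (T k)
gaussTerm-≈[]-q^T n k k≤n = begin
  q^ (T k) ⊛ P ⊛ P′      ≈⟨ ≈⇒≈[] (⊛-assoc (q^ (T k)) P P′) ⟩
  q^ (T k) ⊛ (P ⊛ P′)    ≈⟨ ≈[]-weaken precision (q^-⊛-≈[] (T k) P⊛P′≈1) ⟩
  q^ (T k) ⊛ one         ≈⟨ ≈⇒≈[] (⊛-identityʳ (q^ (T k))) ⟩
  q^ (T k)               ∎
  where
  open ≈[]-Reasoning (suc n)
  s = suc n ∸ k
  P  = pochFin 1ℤ s k
  P′ = pochFin 1ℤ (suc (suc (n + k))) (n ∸ k)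
  P⊛P′≈1 : P ⊛ P′ ≈[ s ] one
  P⊛P′≈1 = ≈[]-trans (⊛-cong[] (pochFin-≈[]-one 1ℤ s k)
                               (≈[]-weaken s≤start (pochFin-≈[]-one 1ℤ _ (n ∸ k))))
                     (≈⇒≈[] (⊛-identityˡ one))
    where
    s≤start : s ≤ suc (suc (n + k))
    s≤start = ℕ.≤-trans (ℕ.m∸n≤m (suc n) k) (s≤s (ℕ.≤-trans (ℕ.m≤m+n n k) (ℕ.n≤1+n _)))
  precision : suc n ≤ T k + s
  precision = subst (_≤ T k + s) (ℕ.m+[n∸m]≡n (ℕ.m≤n⇒m≤1+n k≤n)) (ℕ.+-monoˡ-≤ s (k≤Tk k))

gaussTerm-top : ∀ n → gaussTerm (suc n) (suc n) ≈ gaussCert n (suc n)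
gaussTerm-top n rewrite ℕ.m+n∸n≡m 1 n | ℕ.n∸n≡0 n =
  ⊛-congʳ one (≈-sym (⊛-assoc (q^ (T n + suc n)) (pochFin 1ℤ 1 n) (oneMinus 1ℤ (suc n))))

-- Multiplying by Z = 1 − q^{2n+2} completes the block (q^{n+k+2};q)_{n−k} of gaussTerm n k to
-- (q^{n+k+2};q)_{n−k+1}, whose first factor can then be split off; Z is cancelled at the end.
module GaussStep₀ (n : ℕ) where

  x u B Z : PS
  x = q^ (suc n)
  u = q^ 1
  B = pochFin 1ℤ (suc (suc (suc (n + 0)))) n
  Z = oneMinus 1ℤ (suc (suc (n + 0)) + n)

  exp-2n+2 : ∀ m → suc m + suc m ≡ suc (suc (m + 0)) + m
  exp-2n+2 = ℕ-solve-∀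

  exp-2n+3 : ∀ m → suc m + suc m + 1 ≡ suc (suc (suc (m + 0))) + m
  exp-2n+3 = ℕ-solve-∀

  exp-n+2 : ∀ m → suc m + 1 ≡ suc (suc (m + 0))
  exp-n+2 = ℕ-solve-∀

  Z≈ : Z ≈ one -ˢ x ⊛ x
  Z≈ = oneMinus-1-monomial (suc n) (suc n ∷ []) (exp-2n+2 n)

  F₁≈ : gaussTerm (suc n) 0 ≈ B ⊛ (one -ˢ x ⊛ x ⊛ u)
  F₁≈ = ≈-trans (q^0⊛one⊛f≈f _) (⊛-congˡ B (oneMinus-1-monomial (suc n) (suc n ∷ 1 ∷ []) (exp-2n+3 n)))

  F₀Z≈ : gaussTerm n 0 ⊛ Z ≈ (one -ˢ x ⊛ u) ⊛ B
  F₀Z≈ = begin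
    gaussTerm n 0 ⊛ Z                      ≈⟨ ⊛-congʳ Z (q^0⊛one⊛f≈f (pochFin 1ℤ (suc (suc (n + 0))) n)) ⟩
    pochFin 1ℤ (suc (suc (n + 0))) (suc n)  ≈⟨ pochFin-front 1ℤ (suc (suc (n + 0))) n ⟩
    oneMinus 1ℤ (suc (suc (n + 0))) ⊛ B    ≈⟨ ⊛-congʳ B (oneMinus-1-monomial (suc n) (1 ∷ []) (exp-n+2 n)) ⟩
    (one -ˢ x ⊛ u) ⊛ B                     ∎
    where open ≈-Reasoning

  G₁≈ : gaussCert n 1 ≈ x ⊛ one ⊛ (one -ˢ u) ⊛ B
  G₁≈ = ⊛-congʳ B (⊛-congˡ (x ⊛ one) (oneMinus-1 1))

  identity : B ⊛ (one -ˢ x ⊛ x ⊛ u) ⊛ (one -ˢ x ⊛ x)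
               -ˢ (one +ˢ x) ⊛ (one +ˢ x) ⊛ (one -ˢ x) ⊛ ((one -ˢ x ⊛ u) ⊛ B)
             ≈ (-ˢ (x ⊛ one ⊛ (one -ˢ u) ⊛ B)) ⊛ (one -ˢ x ⊛ x)
  identity = solve 3 (λ x u B →
      B ⊗ (1ₑ ⊕ ⊝ (x ⊗ x ⊗ u)) ⊗ (1ₑ ⊕ ⊝ (x ⊗ x))
        ⊕ ⊝ ((1ₑ ⊕ x) ⊗ (1ₑ ⊕ x) ⊗ (1ₑ ⊕ ⊝ x) ⊗ ((1ₑ ⊕ ⊝ (x ⊗ u)) ⊗ B))
      ⊜ (⊝ (x ⊗ 1ₑ ⊗ (1ₑ ⊕ ⊝ u) ⊗ B)) ⊗ (1ₑ ⊕ ⊝ (x ⊗ x)))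
    ≈-refl (ps x) (ps u) (ps B)

  step : gaussTerm (suc n) 0 -ˢ ψ-factor (suc n) ⊛ gaussTerm n 0 ≈ gaussCert n 0 -ˢ gaussCert n 1
  step = ⊛-cancelʳ {Z} refl (begin
    (gaussTerm (suc n) 0 -ˢ ψ-factor (suc n) ⊛ gaussTerm n 0) ⊛ Z
      ≈⟨ ⊛-distribʳ-diff (gaussTerm (suc n) 0) (ψ-factor (suc n)) (gaussTerm n 0) Z ⟩
    gaussTerm (suc n) 0 ⊛ Z -ˢ ψ-factor (suc n) ⊛ (gaussTerm n 0 ⊛ Z)
      ≈⟨ +ˢ-cong (⊛-cong F₁≈ Z≈) (-ˢ-cong (⊛-cong (ψ-factor-monomial (suc n) (suc n) [] refl) F₀Z≈)) ⟩
    B ⊛ (one -ˢ x ⊛ x ⊛ u) ⊛ (one -ˢ x ⊛ x) -ˢ (one +ˢ x) ⊛ (one +ˢ x) ⊛ (one -ˢ x) ⊛ ((one -ˢ x ⊛ u) ⊛ B)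
      ≈⟨ identity ⟩
    (-ˢ (x ⊛ one ⊛ (one -ˢ u) ⊛ B)) ⊛ (one -ˢ x ⊛ x)
      ≈⟨ ⊛-cong (≈-trans (+ˢ-identityˡ (-ˢ gaussCert n 1)) (-ˢ-cong G₁≈)) Z≈ ⟨
    (0ˢ -ˢ gaussCert n 1) ⊛ Z ∎)
    where open ≈-Reasoning

-- With n = k + 1 + a, the variables of `identity` stand for t = q^{T k}, y = q^{k+1},
-- r = q^{a+1}, u = q, A = (q^{a+2};q)_k and B = (q^{n+k+4};q)_a.
module GaussStep₊ (k a : ℕ) where

  n : ℕ
  n = suc k + a

  t y r u A B Z : PS
  t = q^ (T k)
  y = q^ (suc k)
  r = q^ (suc a)
  u = q^ 1
  A = pochFin 1ℤ (suc (suc a)) k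
  B = pochFin 1ℤ (suc (suc (suc (n + suc k)))) a
  Z = oneMinus 1ℤ (suc (suc (n + suc k)) + a)

  exp-2+k+a : ∀ k a → suc (suc (k + a)) ≡ k + suc (suc a)
  exp-2+k+a = ℕ-solve-∀

  exp-n+1 : ∀ k a → suc a + suc k ≡ suc (suc k + a)
  exp-n+1 = ℕ-solve-∀

  exp-2n+2 : ∀ k a → suc a + suc a + suc k + suc k ≡ suc (suc (suc k + a + suc k)) + a
  exp-2n+2 = ℕ-solve-∀

  exp-2n+3 : ∀ k a → suc a + suc a + suc k + suc k + 1 ≡ suc (suc (suc (suc k + a) + suc k)) + a
  exp-2n+3 = ℕ-solve-∀

  exp-n+k+3 : ∀ k a → suc a + suc k + suc k + 1 ≡ suc (suc (suc k + a + suc k))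
  exp-n+k+3 = ℕ-solve-∀

  exp-n+k+3′ : ∀ k a → suc a + suc k + suc k + 1 ≡ suc (suc (suc (suc k + a + k)))
  exp-n+k+3′ = ℕ-solve-∀

  exp-Tk+n+1 : ∀ t k a → t + suc a + suc k ≡ t + suc (suc k + a)
  exp-Tk+n+1 = ℕ-solve-∀

  exp-TK+n+1 : ∀ t k a → t + suc k + suc a + suc k ≡ t + suc k + suc (suc k + a)
  exp-TK+n+1 = ℕ-solve-∀

  n+1∸k : suc n ∸ k ≡ suc (suc a)
  n+1∸k = m≡k+b⇒m∸k≡b k (exp-2+k+a k a)

  n∸k : n ∸ k ≡ suc a
  n∸k = m≡k+b⇒m∸k≡b k (sym (ℕ.+-suc k a))

  Z≈ : Z ≈ one -ˢ r ⊛ r ⊛ y ⊛ y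
  Z≈ = oneMinus-1-monomial (suc a) (suc a ∷ suc k ∷ suc k ∷ []) (exp-2n+2 k a)

  m≈ : ψ-factor (suc n) ≈ (one +ˢ r ⊛ y) ⊛ (one +ˢ r ⊛ y) ⊛ (one -ˢ r ⊛ y)
  m≈ = ψ-factor-monomial (suc n) (suc a) (suc k ∷ []) (exp-n+1 k a)

  ryyu : ∀ {e} → suc a + suc k + suc k + 1 ≡ e → oneMinus 1ℤ e ≈ one -ˢ r ⊛ y ⊛ y ⊛ u
  ryyu = oneMinus-1-monomial (suc a) (suc k ∷ suc k ∷ 1 ∷ [])

  P≈ : pochFin 1ℤ (suc a) (suc k) ≈ (one -ˢ r) ⊛ A
  P≈ = ≈-trans (pochFin-front 1ℤ (suc a) k) (⊛-congʳ A (oneMinus-1 (suc a)))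

  F₁≈ : gaussTerm (suc n) (suc k) ≈ (t ⊛ y) ⊛ (A ⊛ (one -ˢ r ⊛ y)) ⊛ (B ⊛ (one -ˢ r ⊛ r ⊛ y ⊛ y ⊛ u))
  F₁≈ rewrite n+1∸k | n∸k =
    ⊛-cong (⊛-cong (q^-monomial (T k) (suc k ∷ []) refl)
                   (⊛-congˡ A (oneMinus-1-monomial (suc a) (suc k ∷ []) (ℕ.+-suc (suc a) k))))
           (⊛-congˡ B (oneMinus-1-monomial (suc a) (suc a ∷ suc k ∷ suc k ∷ 1 ∷ []) (exp-2n+3 k a)))

  F₀Z≈ : gaussTerm n (suc k) ⊛ Z ≈ (t ⊛ y) ⊛ ((one -ˢ r) ⊛ A) ⊛ ((one -ˢ r ⊛ y ⊛ y ⊛ u) ⊛ B)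
  F₀Z≈ rewrite n∸k | ℕ.m+n∸m≡n k a = begin
    (q^ (T (suc k)) ⊛ P ⊛ pochFin 1ℤ s a) ⊛ Z
      ≈⟨ ⊛-assoc (q^ (T (suc k)) ⊛ P) (pochFin 1ℤ s a) Z ⟩
    q^ (T (suc k)) ⊛ P ⊛ pochFin 1ℤ s (suc a)
      ≈⟨ ⊛-cong (⊛-cong (q^-monomial (T k) (suc k ∷ []) refl) P≈)
                (≈-trans (pochFin-front 1ℤ s a) (⊛-congʳ B (ryyu (exp-n+k+3 k a)))) ⟩
    (t ⊛ y) ⊛ ((one -ˢ r) ⊛ A) ⊛ ((one -ˢ r ⊛ y ⊛ y ⊛ u) ⊛ B) ∎
    where
    open ≈-Reasoning
    s = suc (suc (n + suc k))
    P = pochFin 1ℤ (suc a) (suc k)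

  G₁≈ : gaussCert n (suc k) ≈ t ⊛ r ⊛ y ⊛ A ⊛ (one -ˢ y) ⊛ ((one -ˢ r ⊛ y ⊛ y ⊛ u) ⊛ B)
  G₁≈ rewrite n+1∸k | n∸k =
    ⊛-cong (⊛-cong (⊛-congʳ A (q^-monomial (T k) (suc a ∷ suc k ∷ []) (exp-Tk+n+1 (T k) k a)))
                   (oneMinus-1 (suc k)))
           (≈-trans (pochFin-front 1ℤ s a)
                    (⊛-cong (ryyu (exp-n+k+3′ k a))
                            (≈-reflexive (cong (λ s → pochFin 1ℤ (3 + s) a) (sym (ℕ.+-suc n k))))))
    where s = suc (suc (suc (n + k)))

  G₂≈ : gaussCert n (suc (suc k)) ≈ t ⊛ y ⊛ r ⊛ y ⊛ ((one -ˢ r) ⊛ A) ⊛ (one -ˢ y ⊛ u) ⊛ B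
  G₂≈ rewrite n∸k | ℕ.m+n∸m≡n k a =
    ⊛-congʳ B (⊛-cong (⊛-cong (q^-monomial (T k) (suc k ∷ suc a ∷ suc k ∷ []) (exp-TK+n+1 (T k) k a)) P≈)
                      (oneMinus-1-monomial (suc k) (1 ∷ []) (ℕ.+-comm (suc k) 1)))

  identity :
    (t ⊛ y) ⊛ (A ⊛ (one -ˢ r ⊛ y)) ⊛ (B ⊛ (one -ˢ r ⊛ r ⊛ y ⊛ y ⊛ u)) ⊛ (one -ˢ r ⊛ r ⊛ y ⊛ y)
      -ˢ (one +ˢ r ⊛ y) ⊛ (one +ˢ r ⊛ y) ⊛ (one -ˢ r ⊛ y)
           ⊛ ((t ⊛ y) ⊛ ((one -ˢ r) ⊛ A) ⊛ ((one -ˢ r ⊛ y ⊛ y ⊛ u) ⊛ B))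
    ≈ (t ⊛ r ⊛ y ⊛ A ⊛ (one -ˢ y) ⊛ ((one -ˢ r ⊛ y ⊛ y ⊛ u) ⊛ B)
         -ˢ t ⊛ y ⊛ r ⊛ y ⊛ ((one -ˢ r) ⊛ A) ⊛ (one -ˢ y ⊛ u) ⊛ B) ⊛ (one -ˢ r ⊛ r ⊛ y ⊛ y)
  identity = solve 6 (λ t y r u A B →
      (t ⊗ y) ⊗ (A ⊗ (1ₑ ⊕ ⊝ (r ⊗ y))) ⊗ (B ⊗ (1ₑ ⊕ ⊝ (r ⊗ r ⊗ y ⊗ y ⊗ u))) ⊗ (1ₑ ⊕ ⊝ (r ⊗ r ⊗ y ⊗ y))
        ⊕ ⊝ ((1ₑ ⊕ r ⊗ y) ⊗ (1ₑ ⊕ r ⊗ y) ⊗ (1ₑ ⊕ ⊝ (r ⊗ y))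
               ⊗ ((t ⊗ y) ⊗ ((1ₑ ⊕ ⊝ r) ⊗ A) ⊗ ((1ₑ ⊕ ⊝ (r ⊗ y ⊗ y ⊗ u)) ⊗ B)))
      ⊜ (t ⊗ r ⊗ y ⊗ A ⊗ (1ₑ ⊕ ⊝ y) ⊗ ((1ₑ ⊕ ⊝ (r ⊗ y ⊗ y ⊗ u)) ⊗ B)
           ⊕ ⊝ (t ⊗ y ⊗ r ⊗ y ⊗ ((1ₑ ⊕ ⊝ r) ⊗ A) ⊗ (1ₑ ⊕ ⊝ (y ⊗ u)) ⊗ B)) ⊗ (1ₑ ⊕ ⊝ (r ⊗ r ⊗ y ⊗ y)))
    ≈-refl (ps t) (ps y) (ps r) (ps u) (ps A) (ps B)

  step : gaussTerm (suc n) (suc k) -ˢ ψ-factor (suc n) ⊛ gaussTerm n (suc k)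
         ≈ gaussCert n (suc k) -ˢ gaussCert n (suc (suc k))
  step = ⊛-cancelʳ {Z} refl
    (≈-trans (⊛-distribʳ-diff (gaussTerm (suc n) (suc k)) (ψ-factor (suc n)) (gaussTerm n (suc k)) Z)
    (≈-trans (+ˢ-cong (⊛-cong F₁≈ Z≈) (-ˢ-cong (⊛-cong m≈ F₀Z≈)))
    (≈-trans identity
             (≈-sym (⊛-cong (+ˢ-cong G₁≈ (-ˢ-cong G₂≈)) Z≈)))))

gaussTerm-step : ∀ n k → k ≤ n →
  gaussTerm (suc n) k -ˢ ψ-factor (suc n) ⊛ gaussTerm n k ≈ gaussCert n k -ˢ gaussCert n (suc k)
gaussTerm-step n zero    _   = GaussStep₀.step n
gaussTerm-step n (suc k) k<n with ℕ.m≤n⇒∃[o]m+o≡n k<n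
... | a , refl = GaussStep₊.step k a

gaussSum-telescope : ∀ n j → j ≤ suc n →
  Σˢ j (gaussTerm (suc n)) -ˢ ψ-factor (suc n) ⊛ Σˢ j (gaussTerm n) ≈ -ˢ gaussCert n j
gaussSum-telescope n zero    _ = -ˢ-congˡ 0ˢ (⊛-zeroʳ (ψ-factor (suc n)))
gaussSum-telescope n (suc j) j<1+n = begin
  (S₁ +ˢ F₁) -ˢ m ⊛ (S₀ +ˢ F₀)
    ≈⟨ solve 5 (λ S₁ F₁ m S₀ F₀ → (S₁ ⊕ F₁) ⊕ ⊝ (m ⊗ (S₀ ⊕ F₀)) ⊜ ((S₁ ⊕ ⊝ (m ⊗ S₀)) ⊕ (F₁ ⊕ ⊝ (m ⊗ F₀))))
               ≈-refl (ps S₁) (ps F₁) (ps m) (ps S₀) (ps F₀) ⟩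
  (S₁ -ˢ m ⊛ S₀) +ˢ (F₁ -ˢ m ⊛ F₀)
    ≈⟨ +ˢ-cong (gaussSum-telescope n j (ℕ.<⇒≤ j<1+n)) (gaussTerm-step n j (ℕ.≤-pred j<1+n)) ⟩
  -ˢ gaussCert n j +ˢ (gaussCert n j -ˢ gaussCert n (suc j))
    ≈⟨ solve 2 (λ g g′ → ⊝ g ⊕ (g ⊕ ⊝ g′) ⊜ ⊝ g′) ≈-refl (ps (gaussCert n j)) (ps (gaussCert n (suc j))) ⟩
  -ˢ gaussCert n (suc j) ∎
  where
  open ≈-Reasoning
  S₁ = Σˢ j (gaussTerm (suc n))
  S₀ = Σˢ j (gaussTerm n)
  F₁ = gaussTerm (suc n) j
  F₀ = gaussTerm n j
  m  = ψ-factor (suc n)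

gaussSum-suc : ∀ n → Σˢ (suc (suc n)) (gaussTerm (suc n)) ≈ ψ-factor (suc n) ⊛ Σˢ (suc n) (gaussTerm n)
gaussSum-suc n = begin
  S₁ +ˢ gaussTerm (suc n) (suc n)
    ≈⟨ solve 4 (λ S₁ F m S₀ → S₁ ⊕ F ⊜ ((S₁ ⊕ ⊝ (m ⊗ S₀)) ⊕ F ⊕ m ⊗ S₀))
               ≈-refl (ps S₁) (ps (gaussTerm (suc n) (suc n))) (ps m) (ps S₀) ⟩
  (S₁ -ˢ m ⊛ S₀) +ˢ gaussTerm (suc n) (suc n) +ˢ m ⊛ S₀
    ≈⟨ +ˢ-cong (+ˢ-cong (gaussSum-telescope n (suc n) ℕ.≤-refl) (gaussTerm-top n)) ≈-refl ⟩
  -ˢ gaussCert n (suc n) +ˢ gaussCert n (suc n) +ˢ m ⊛ S₀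
    ≈⟨ solve 2 (λ g x → ⊝ g ⊕ g ⊕ x ⊜ x) ≈-refl (ps (gaussCert n (suc n))) (ps (m ⊛ S₀)) ⟩
  m ⊛ S₀ ∎
  where
  open ≈-Reasoning
  S₁ = Σˢ (suc n) (gaussTerm (suc n))
  S₀ = Σˢ (suc n) (gaussTerm n)
  m  = ψ-factor (suc n)

Ψ-fin≈gaussSum : ∀ n → Ψ-fin n ≈ Σˢ (suc n) (gaussTerm n)
Ψ-fin≈gaussSum zero    = begin
  one ⊛ one ⊛ one           ≈⟨ ⊛-identityʳ (one ⊛ one) ⟩
  one ⊛ one                 ≈⟨ ⊛-identityˡ one ⟩
  one                       ≈⟨ q^0⊛one⊛f≈f one ⟨
  gaussTerm 0 0             ≈⟨ +ˢ-identityˡ (gaussTerm 0 0) ⟨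
  0ˢ +ˢ gaussTerm 0 0       ∎
  where open ≈-Reasoning
Ψ-fin≈gaussSum (suc n) = begin
  Ψ-fin (suc n)                                  ≈⟨ Ψ-fin-suc n ⟩
  Ψ-fin n ⊛ ψ-factor (suc n)                     ≈⟨ ⊛-congʳ (ψ-factor (suc n)) (Ψ-fin≈gaussSum n) ⟩
  Σˢ (suc n) (gaussTerm n) ⊛ ψ-factor (suc n)    ≈⟨ ⊛-comm (Σˢ (suc n) (gaussTerm n)) (ψ-factor (suc n)) ⟩
  ψ-factor (suc n) ⊛ Σˢ (suc n) (gaussTerm n)    ≈⟨ gaussSum-suc n ⟨
  Σˢ (suc (suc n)) (gaussTerm (suc n))           ∎
  where open ≈-Reasoning

triangularSum : ℕ → PS
triangularSum N = Σˢ N (λ a → q^ (T a))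

Ψ-≈[]-triangularSum : ∀ n → Ψ 1 ≈[ suc n ] triangularSum (suc n)
Ψ-≈[]-triangularSum n = begin
  Ψ 1
    ≈⟨ Ψ-≈[]-Ψ-fin n ⟩
  Ψ-fin n
    ≈⟨ ≈⇒≈[] (Ψ-fin≈gaussSum n) ⟩
  Σˢ (suc n) (gaussTerm n)
    ≈⟨ Σˢ-cong[] (suc n) (λ k k<1+n → gaussTerm-≈[]-q^T n k (ℕ.≤-pred k<1+n)) ⟩
  triangularSum (suc n) ∎
  where open ≈[]-Reasoning (suc n)

-- The series Σₙ qⁿ Φ n

Φ : ℕ → PS
Φ n = pochFin 1ℤ (suc n) n ⊛ Ψ (suc n)

F : ℕ → ℕ → PS
F j N = Σˢ N (λ n → q^ (n * suc (j + j)) ⊛ Φ n)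

Φ-recurrence : ∀ n → Φ (suc n) ⊛ oneMinus 1ℤ (suc (suc (n + n))) ≈ Φ n ⊛ oneMinus 1ℤ (suc (n + n))
Φ-recurrence n = begin
  (A ⊛ oneMinus 1ℤ (suc (suc n) + n)) ⊛ R ⊛ oneMinus 1ℤ (suc (suc (n + n)))
    ≈⟨ ⊛-cong (⊛-congʳ R (⊛-congˡ A (oneMinus-1-⊛ (suc n) (suc n) (ℕ.+-suc (suc n) n))))
              (oneMinus-1-⊛ (suc n) (suc n) (cong suc (ℕ.+-suc n n))) ⟩
  (A ⊛ (one -ˢ x ⊛ x)) ⊛ R ⊛ (one -ˢ x ⊛ x)
    ≈⟨ solve 3 (λ x A R → (A ⊗ (1ₑ ⊕ ⊝ (x ⊗ x))) ⊗ R ⊗ (1ₑ ⊕ ⊝ (x ⊗ x))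
                        ⊜ ((1ₑ ⊕ ⊝ x) ⊗ A) ⊗ ((1ₑ ⊕ x) ⊗ (1ₑ ⊕ x) ⊗ (1ₑ ⊕ ⊝ x) ⊗ R))
               ≈-refl (ps x) (ps A) (ps R) ⟩
  ((one -ˢ x) ⊛ A) ⊛ (ψ-factor (suc n) ⊛ R)
    ≈⟨ ⊛-cong (≈-trans (pochFin-front 1ℤ (suc n) n) (⊛-congʳ A (oneMinus-1 (suc n)))) (Ψ-front (suc n)) ⟨
  pochFin 1ℤ (suc n) (suc n) ⊛ Ψ (suc n)
    ≈⟨ solve 3 (λ P Z S → (P ⊗ Z) ⊗ S ⊜ (P ⊗ S) ⊗ Z)
               ≈-refl (ps P) (ps (oneMinus 1ℤ (suc (n + n)))) (ps (Ψ (suc n))) ⟩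
  Φ n ⊛ oneMinus 1ℤ (suc (n + n)) ∎
  where
  open ≈-Reasoning
  x = q^ (suc n)
  A = pochFin 1ℤ (suc (suc n)) n
  P = pochFin 1ℤ (suc n) n
  R = Ψ (suc (suc n))

module FRelation (j : ℕ) where

  s : ℕ
  s = suc (j + j)

  z u : PS
  z = q^ s
  u = q^ 1

  exp-w′ : ∀ j N → suc N * suc (j + j) + suc (N + N) + 1 ≡ suc N * suc (suc j + suc j)
  exp-w′ = ℕ-solve-∀

  exp-2N+3 : ∀ N → suc (N + N) + 1 + 1 ≡ suc (suc N + suc N)
  exp-2N+3 = ℕ-solve-∀

  A≈ : oneMinus 1ℤ s ≈ one -ˢ z
  A≈ = oneMinus-1 s

  A′≈ : oneMinus 1ℤ (suc s) ≈ one -ˢ z ⊛ u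
  A′≈ = oneMinus-1-⊛ s 1 (ℕ.+-comm s 1)

  split-last : ∀ A A′ F F′ x x′ →
    A ⊛ (F +ˢ x) -ˢ A′ ⊛ (F′ +ˢ x′) ≈ (A ⊛ F -ˢ A′ ⊛ F′) +ˢ (A ⊛ x -ˢ A′ ⊛ x′)
  split-last A A′ F F′ x x′ = solve 6 (λ A A′ F F′ x x′ →
      A ⊗ (F ⊕ x) ⊕ ⊝ (A′ ⊗ (F′ ⊕ x′)) ⊜ ((A ⊗ F ⊕ ⊝ (A′ ⊗ F′)) ⊕ (A ⊗ x ⊕ ⊝ (A′ ⊗ x′))))
    ≈-refl (ps A) (ps A′) (ps F) (ps F′) (ps x) (ps x′)

  step-identity : ∀ w v φ →
    -ˢ (w ⊛ (φ ⊛ (one -ˢ v ⊛ u))) +ˢ ((one -ˢ z) ⊛ (w ⊛ φ) -ˢ (one -ˢ z ⊛ u) ⊛ ((w ⊛ v ⊛ u) ⊛ φ))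
      ≈ -ˢ ((z ⊛ w) ⊛ (φ ⊛ (one -ˢ v ⊛ u ⊛ u)))
  step-identity w v φ = solve 5 (λ z u v w φ →
      ⊝ (w ⊗ (φ ⊗ (1ₑ ⊕ ⊝ (v ⊗ u)))) ⊕ ((1ₑ ⊕ ⊝ z) ⊗ (w ⊗ φ) ⊕ ⊝ ((1ₑ ⊕ ⊝ (z ⊗ u)) ⊗ ((w ⊗ v ⊗ u) ⊗ φ)))
      ⊜ ⊝ ((z ⊗ w) ⊗ (φ ⊗ (1ₑ ⊕ ⊝ (v ⊗ u ⊗ u)))))
    ≈-refl (ps z) (ps u) (ps v) (ps w) (ps φ)

  relation : ∀ N →
    oneMinus 1ℤ s ⊛ F j (suc N) -ˢ oneMinus 1ℤ (suc s) ⊛ F (suc j) (suc N)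
      ≈ -ˢ (q^ (suc N * s) ⊛ (Φ N ⊛ oneMinus 1ℤ (suc (N + N))))
  relation zero = begin
    oneMinus 1ℤ s ⊛ T₀ -ˢ oneMinus 1ℤ (suc s) ⊛ T₀
      ≈⟨ +ˢ-cong (⊛-cong A≈ T₀≈) (-ˢ-cong (⊛-cong A′≈ T₀≈)) ⟩
    (one -ˢ z) ⊛ Φ 0 -ˢ (one -ˢ z ⊛ u) ⊛ Φ 0
      ≈⟨ solve 3 (λ z u φ → (1ₑ ⊕ ⊝ z) ⊗ φ ⊕ ⊝ ((1ₑ ⊕ ⊝ (z ⊗ u)) ⊗ φ) ⊜ ⊝ (z ⊗ (φ ⊗ (1ₑ ⊕ ⊝ u))))
                 ≈-refl (ps z) (ps u) (ps (Φ 0)) ⟩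
    -ˢ (z ⊛ (Φ 0 ⊛ (one -ˢ u)))
      ≈⟨ -ˢ-cong (⊛-cong (≈-reflexive (cong q^ (ℕ.+-identityʳ s))) (⊛-congˡ (Φ 0) (oneMinus-1 1))) ⟨
    -ˢ (q^ (1 * s) ⊛ (Φ 0 ⊛ oneMinus 1ℤ 1)) ∎
    where
    open ≈-Reasoning
    T₀ = 0ˢ +ˢ q^ 0 ⊛ Φ 0
    T₀≈ : T₀ ≈ Φ 0
    T₀≈ = ≈-trans (+ˢ-identityˡ (q^ 0 ⊛ Φ 0)) (⊛-identityˡ (Φ 0))
  relation (suc N) = begin
    A ⊛ (F j (suc N) +ˢ w ⊛ φ) -ˢ A′ ⊛ (F (suc j) (suc N) +ˢ w′ ⊛ φ)
      ≈⟨ split-last A A′ (F j (suc N)) (F (suc j) (suc N)) (w ⊛ φ) (w′ ⊛ φ) ⟩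
    (A ⊛ F j (suc N) -ˢ A′ ⊛ F (suc j) (suc N)) +ˢ (A ⊛ (w ⊛ φ) -ˢ A′ ⊛ (w′ ⊛ φ))
      ≈⟨ +ˢ-cong (≈-trans (relation N) (-ˢ-cong (⊛-congˡ w (≈-sym (Φ-recurrence N))))) ≈-refl ⟩
    -ˢ (w ⊛ (φ ⊛ oneMinus 1ℤ (suc (suc (N + N))))) +ˢ (A ⊛ (w ⊛ φ) -ˢ A′ ⊛ (w′ ⊛ φ))
      ≈⟨ +ˢ-cong (-ˢ-cong (⊛-congˡ w (⊛-congˡ φ (oneMinus-1-⊛ v 1 (ℕ.+-comm v 1)))))
                 (+ˢ-cong (⊛-congʳ (w ⊛ φ) A≈) (-ˢ-cong (⊛-cong A′≈ (⊛-congʳ φ w′≈)))) ⟩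
    -ˢ (w ⊛ (φ ⊛ (one -ˢ q^ v ⊛ u))) +ˢ ((one -ˢ z) ⊛ (w ⊛ φ) -ˢ (one -ˢ z ⊛ u) ⊛ ((w ⊛ q^ v ⊛ u) ⊛ φ))
      ≈⟨ step-identity w (q^ v) φ ⟩
    -ˢ ((z ⊛ w) ⊛ (φ ⊛ (one -ˢ q^ v ⊛ u ⊛ u)))
      ≈⟨ -ˢ-cong (⊛-cong (q^-+ s (suc N * s)) (⊛-congˡ φ (oneMinus-1-monomial v (1 ∷ 1 ∷ []) (exp-2N+3 N)))) ⟨
    -ˢ (q^ (suc (suc N) * s) ⊛ (φ ⊛ oneMinus 1ℤ (suc (suc N + suc N)))) ∎
    where
    open ≈-Reasoning
    v = suc (N + N)
    A = oneMinus 1ℤ s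
    A′ = oneMinus 1ℤ (suc s)
    w = q^ (suc N * s)
    w′ = q^ (suc N * suc (suc j + suc j))
    φ = Φ (suc N)
    w′≈ : w′ ≈ w ⊛ q^ v ⊛ u
    w′≈ = q^-monomial (suc N * s) (v ∷ 1 ∷ []) (exp-w′ j N)

F-relation : ∀ j N →
  oneMinus 1ℤ (suc (j + j)) ⊛ F j (suc N) -ˢ oneMinus 1ℤ (suc (suc (j + j))) ⊛ F (suc j) (suc N)
    ≈ -ˢ (q^ (suc N * suc (j + j)) ⊛ (Φ N ⊛ oneMinus 1ℤ (suc (N + N))))
F-relation = FRelation.relation

F-relation-≈[] : ∀ j M →
  oneMinus 1ℤ (suc (j + j)) ⊛ F j M ≈[ M ] oneMinus 1ℤ (suc (suc (j + j))) ⊛ F (suc j) M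
F-relation-≈[] j zero    = coeffwise< λ _ ()
F-relation-≈[] j (suc N) = coeffwise< λ k k<1+N → ℤ.i-j≡0⇒i≡j _ _
  (trans (coeff (F-relation j N) k)
         (cong -ℤ_ (coeff< (≈[]-weaken 1+N≤e (q^-⊛-≈[]-0 e (Φ N ⊛ oneMinus 1ℤ (suc (N + N))))) k k<1+N)))
  where
  e = suc N * suc (j + j)
  1+N≤e : suc N ≤ e
  1+N≤e = ℕ.m≤m*n (suc N) (suc (j + j))

F-iterate : ∀ J M → oddPoch J ⊛ F 0 M ≈[ M ] evenPoch J ⊛ F J M
F-iterate zero    M = ≈[]-refl
F-iterate (suc J) M = begin
  (oddPoch J ⊛ O) ⊛ F 0 M
    ≈⟨ ≈⇒≈[] (solve 3 (λ o O f → (o ⊗ O) ⊗ f ⊜ O ⊗ (o ⊗ f)) ≈-refl (ps (oddPoch J)) (ps O) (ps (F 0 M))) ⟩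
  O ⊛ (oddPoch J ⊛ F 0 M)
    ≈⟨ ⊛-cong[] {O} ≈[]-refl (F-iterate J M) ⟩
  O ⊛ (evenPoch J ⊛ F J M)
    ≈⟨ ≈⇒≈[] (solve 3 (λ O e f → O ⊗ (e ⊗ f) ⊜ e ⊗ (O ⊗ f)) ≈-refl (ps O) (ps (evenPoch J)) (ps (F J M))) ⟩
  evenPoch J ⊛ (O ⊛ F J M)
    ≈⟨ ⊛-cong[] {evenPoch J} ≈[]-refl (F-relation-≈[] J M) ⟩
  evenPoch J ⊛ (E ⊛ F (suc J) M)
    ≈⟨ ≈⇒≈[] (⊛-assoc (evenPoch J) E (F (suc J) M)) ⟨
  (evenPoch J ⊛ E) ⊛ F (suc J) M ∎
  where
  open ≈[]-Reasoning M
  O = oneMinus 1ℤ (suc (J + J))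
  E = oneMinus 1ℤ (suc (suc (J + J)))

F-≈[]-Ψ : ∀ j N → F j (suc N) ≈[ suc (j + j) ] Ψ 1
F-≈[]-Ψ j zero    = ≈⇒≈[] (≈-trans (+ˢ-identityˡ (q^ 0 ⊛ Φ 0))
                                   (≈-trans (⊛-identityˡ (Φ 0)) (⊛-identityˡ (Ψ 1))))
F-≈[]-Ψ j (suc N) = ≈[]-trans
  (+ˢ-cong[] (F-≈[]-Ψ j N)
             (≈[]-weaken (ℕ.m≤m+n (suc (j + j)) _) (q^-⊛-≈[]-0 (suc N * suc (j + j)) (Φ (suc N)))))
  (≈⇒≈[] (+ˢ-identityʳ (Ψ 1)))

F0-≈[]-Ψ² : ∀ K → F 0 (suc K) ≈[ suc K ] Ψ 1 ⊛ Ψ 1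
F0-≈[]-Ψ² K = ⊛-cancelʳ[] {oddPoch K} (oddPoch-at-0 K) (begin
  F 0 (suc K) ⊛ oddPoch K
    ≈⟨ ≈⇒≈[] (⊛-comm (F 0 (suc K)) (oddPoch K)) ⟩
  oddPoch K ⊛ F 0 (suc K)
    ≈⟨ F-iterate K (suc K) ⟩
  evenPoch K ⊛ F K (suc K)
    ≈⟨ ⊛-cong[] {evenPoch K} ≈[]-refl (≈[]-weaken K+1≤2K+1 (F-≈[]-Ψ K K)) ⟩
  evenPoch K ⊛ Ψ 1
    ≈⟨ ⊛-cong[] {g = Ψ 1} (≈[]-weaken K+1≤2K+1 (oddPoch⊛Ψ K)) ≈[]-refl ⟨
  (oddPoch K ⊛ Ψ 1) ⊛ Ψ 1
    ≈⟨ ≈⇒≈[] (solve 2 (λ o p → (o ⊗ p) ⊗ p ⊜ (p ⊗ p) ⊗ o) ≈-refl (ps (oddPoch K)) (ps (Ψ 1))) ⟩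
  (Ψ 1 ⊛ Ψ 1) ⊛ oddPoch K ∎)
  where
  open ≈[]-Reasoning (suc K)
  K+1≤2K+1 : suc K ≤ suc (K + K)
  K+1≤2K+1 = s≤s (ℕ.m≤m+n K K)

triangularSum-support : ∀ N i → triangularSum N i ≡ 0ℤ ⊎ ∃[ a ] T a ≡ i
triangularSum-support zero    i = inj₁ refl
triangularSum-support (suc N) i with T N ℕ.≟ i
... | yes T≡i = inj₂ (N , T≡i)
... | no  T≢i with triangularSum-support N i
...   | inj₂ triangular = inj₂ triangular
...   | inj₁ sum≡0      = inj₁ (cong₂ _+ℤ_ sum≡0 (q^-coeff-≢ T≢i))

Ψ-support : ∀ i → Ψ 1 i ≡ 0ℤ ⊎ ∃[ a ] T a ≡ i
Ψ-support i with triangularSum-support (suc i) i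
... | inj₁ sum≡0     = inj₁ (trans (coeff< (Ψ-≈[]-triangularSum i) i ℕ.≤-refl) sum≡0)
... | inj₂ triangular = inj₂ triangular

Ψ²-support : ∀ n → ¬ (∃[ a ] ∃[ b ] n ≡ T a + T b) → (Ψ 1 ⊛ Ψ 1) n ≡ 0ℤ
Ψ²-support n not-sum =
  ⊛-coeff-zero (Ψ 1) (Ψ 1) n λ i i≤n → case i i≤n (Ψ-support i) (Ψ-support (n ∸ i))
  where
  case : ∀ i → i ≤ n → Ψ 1 i ≡ 0ℤ ⊎ ∃[ a ] T a ≡ i → Ψ 1 (n ∸ i) ≡ 0ℤ ⊎ ∃[ b ] T b ≡ n ∸ i →
         Ψ 1 i ≡ 0ℤ ⊎ Ψ 1 (n ∸ i) ≡ 0ℤ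
  case i i≤n (inj₁ Ψᵢ≡0) _ = inj₁ Ψᵢ≡0
  case i i≤n (inj₂ _) (inj₁ Ψⱼ≡0) = inj₂ Ψⱼ≡0
  case i i≤n (inj₂ (a , Ta≡i)) (inj₂ (b , Tb≡n∸i)) =
    ⊥-elim (not-sum (a , b , sym (trans (cong₂ _+_ Ta≡i Tb≡n∸i) (ℕ.m+[n∸m]≡n i≤n))))

summand≈q^⊛Φ : ∀ n → summand n ≈ q^ (n * 1) ⊛ Φ n
summand≈q^⊛Φ n = ≈-trans (shift-⊛ n (Ψ (suc n) ⊛ pochFin 1ℤ (suc n) n))
  (⊛-cong (≈-reflexive (cong q^ (sym (ℕ.*-identityʳ n)))) (⊛-comm (Ψ (suc n)) (pochFin 1ℤ (suc n) n)))

Ψ+B′≡Ψ² : ∀ K → Ψ 1 K +ℤ B' K ≡ (Ψ 1 ⊛ Ψ 1) K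
Ψ+B′≡Ψ² K = begin
  Ψ 1 K +ℤ B' K
    ≡⟨ cong₂ _+ℤ_ (sym (coeff term₀≈Ψ K)) (Σ<-cong K λ i _ → coeff (summand≈q^⊛Φ (suc i)) K) ⟩
  term 0 K +ℤ Σ< K (λ i → term (suc i) K)
    ≡⟨ Σ<-head K (λ n → term n K) ⟨
  F 0 (suc K) K
    ≡⟨ coeff< (F0-≈[]-Ψ² K) K ℕ.≤-refl ⟩
  (Ψ 1 ⊛ Ψ 1) K ∎
  where
  open ≡-Reasoning
  term : ℕ → PS
  term n = q^ (n * 1) ⊛ Φ n
  term₀≈Ψ : term 0 ≈ Ψ 1
  term₀≈Ψ = ≈-trans (⊛-identityˡ (Φ 0)) (⊛-identityˡ (Ψ 1))

corollary9p2 : (n : ℕ) → 1 ≤ n → ¬ (∃[ a ] ∃[ b ] n ≡ T a + T b) → B' n ≡ 0ℤ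
corollary9p2 n _ not-sum = begin
  B' n                ≡⟨ ℤ.+-identityˡ (B' n) ⟨
  0ℤ +ℤ B' n          ≡⟨ cong (_+ℤ B' n) Ψₙ≡0 ⟨
  Ψ 1 n +ℤ B' n       ≡⟨ Ψ+B′≡Ψ² n ⟩
  (Ψ 1 ⊛ Ψ 1) n       ≡⟨ Ψ²-support n not-sum ⟩
  0ℤ                  ∎
  where
  open ≡-Reasoning
  Ψₙ≡0 : Ψ 1 n ≡ 0ℤ
  Ψₙ≡0 with Ψ-support n
  ... | inj₁ Ψₙ≡0       = Ψₙ≡0
  ... | inj₂ (a , Ta≡n) = ⊥-elim (not-sum (a , 0 , sym (trans (ℕ.+-identityʳ (T a)) Ta≡n)))
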